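{- Let $\mathcal{H}\subset\mathcal{O}$. Let $\mathfrak{h}=\bigoplus_{i=0}^k\mathfrak{h}^i$ be a Hoffman graph with $\mathfrak{h}^i\in\mathcal{H}$ for every $i$, and let $G$ be an (induced) subgraph of the slim subgraph of $\mathfrak{h}$. Then $(\langle\!\langle V(G)\rangle\!\rangle_{\mathfrak{h}})^{\sim}$ is a strict $\bar{\mathcal{H}}$-cover of $G$. In particular, every slim $\mathcal{H}$-line graph has a strict $\bar{\mathcal{H}}$-cover.
   Context: A Hoffman graph $\mathfrak{h}=(H,\mu)$ is a finite simple graph $H$ with labeling $\mu:V(H)\to\{f,s\}$ such that every fat vertex (label $f$) has a slim neighbour (label $s$), and fat vertices are pairwise non-adjacent. $V_s,V_f$ denote slim/fat vertex sets, $N^f_{\mathfrak{h}}(x)$ the fat neighbours of $x$. A Hoffman subgraph is an induced subgraph with restricted labeling; isomorphisms preserve labels; membership in a family is up to isomorphism. The slim subgraph of $\mathfrak{h}$ is the graph induced on $V_s(\mathfrak{h})$; ordinary graphs are Hoffman graphs with no fat vertices. For $X\subset V_s(\mathfrak{h})$, $\langle\!\langle X\rangle\!\rangle_{\mathfrak{h}}$ is the Hoffman subgraph induced by $X\cup\bigcup_{x\in X}N^f_{\mathfrak{h}}(x)$. Sum: $\mathfrak{h}=\bigoplus_i\mathfrak{h}^i$ (Hoffman subgraphs) means (i) $V(\mathfrak{h})=\bigcup V(\mathfrak{h}^i)$; (ii) $V_s(\mathfrak{h})$ is the disjoint union of the $V_s(\mathfrak{h}^i)$; (iii) $N^f_{\mathfrak{h}^i}(x)=N^f_{\mathfrak{h}}(x)$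 for $x\in V_s(\mathfrak{h}^i)$; (iv) for slim $x\in\mathfrak{h}^i$, $y\in\mathfrak{h}^j$, $i\ne j$: $|N^f_{\mathfrak{h}}(x)\cap N^f_{\mathfrak{h}}(y)|\le1$ with equality iff $x,y$ adjacent. Indecomposable: not a sum of two non-empty Hoffman subgraphs. Fat: every slim vertex has a fat neighbour. $\mathfrak{h}_1$: one slim vertex adjacent to one fat vertex; $\mathfrak{h}_2$: one slim vertex adjacent to two fat vertices. $\mathcal{O}$: $\mathfrak{h}_2$ together with all indecomposable fat Hoffman graphs with at least two slim vertices and exactly one fat vertex. $\bar{\mathcal{H}}=\{\mathfrak{h}_2\}\cup\{\mathfrak{h}\in\mathcal{O}:\mathfrak{h}$ is a Hoffman subgraph of an element of $\mathcal{H}\}$. Tilde: for a Hoffman graph $\mathfrak{n}=\bigoplus_{i=0}^k\mathfrak{n}^i$ with $\mathfrak{n}^0,\dots,\mathfrak{n}^l\simeq\mathfrak{h}_1$ and $\mathfrak{n}^{l+1},\dots,\mathfrak{n}^k\in\mathcal{O}$, $\tilde{\mathfrak{n}}$ is obtained by adding distinct new fat vertices $f_0,\dots,f_l$, $f_i$ adjacent exactly to the slim vertex of $\mathfrak{n}^i$. A Hoffman graph $\mathfrak{g}$ is an $\mathcal{H}$-line Hoffman graph if it is a Hoffman subgraph of a sum of members of $\mathcal{H}$; such a sum is an $\mathcal{H}$-cover, strict if it has the same slim vertex set as $\mathfrak{g}$. A slim $\mathcal{H}$-line graph is an $\mathcal{H}$-line Hoffman graph without fat vertices. -}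

module Defs where

open import Data.Nat using (ℕ; zero; suc; _+_; _≤_)
open import Data.Bool using (Bool; true; false; _∧_; _∨_; not)
open import Data.Fin using (Fin; zero; suc; splitAt; _↑ˡ_; _↑ʳ_)
open import Data.List using (List; length; filterᵇ; lookup)
open import Data.Bool.ListAction using (any)
open import Data.List.Base using (allFin)
open import Data.Sum using (_⊎_; inj₁; inj₂)
open import Data.Product using (Σ; ∃; _×_; _,_)
open import Relation.Nullary using (¬_)
open import Relation.Binary.PropositionalEquality using (_≡_; _≢_)

-- Raw labelled graphs on vertex set Fin n.
-- adj u v = true : u and v adjacent;  fat v = true : label f, false : label s.

record HG : Set where
  field
    n   : ℕ
    adj : Fin n → Fin n → Bool
    fat : Fin n → Bool
open HG public

record IsHoffman (h : HG) : Set where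
  field
    sym   : ∀ u v → adj h u v ≡ adj h v u
    irr   : ∀ u → adj h u u ≡ false
    fatNA : ∀ u v → fat h u ≡ true → fat h v ≡ true → adj h u v ≡ false
    fatSl : ∀ f → fat h f ≡ true → ∃ λ x → fat h x ≡ false × adj h x f ≡ true

count : {m : ℕ} → (Fin m → Bool) → ℕ
count {m} P = length (filterᵇ P (allFin m))

numSlim numFat : HG → ℕ
numSlim h = count (λ v → not (fat h v))
numFat  h = count (fat h)

commonFat : (h : HG) → Fin (n h) → Fin (n h) → ℕ
commonFat h x y = count (λ f → fat h f ∧ (adj h x f ∧ adj h y f))

subV : (h : HG) → (Fin (n h) → Bool) → List (Fin (n h))
subV h P = filterᵇ P (allFin (n h))

sub : (h : HG) → (Fin (n h) → Bool) → HG
sub h P = record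
  { n   = length (subV h P)
  ; adj = λ u v → adj h (lookup (subV h P) u) (lookup (subV h P) v)
  ; fat = λ u → fat h (lookup (subV h P) u)
  }

-- Embeddings (g is isomorphic to a Hoffman subgraph of h) and isomorphisms.

record Emb (g h : HG) : Set where
  field
    ι     : Fin (n g) → Fin (n h)
    inj   : ∀ u v → ι u ≡ ι v → u ≡ v
    adjP  : ∀ u v → adj h (ι u) (ι v) ≡ adj g u v
    fatP  : ∀ u → fat h (ι u) ≡ fat g u
open Emb public

Iso : HG → HG → Set
Iso g h = Σ (Emb g h) λ e → ∀ y → ∃ λ x → ι e x ≡ y

_∈ᶠ_ : HG → (HG → Set) → Set
g ∈ᶠ F = ∃ λ g' → F g' × Iso g' g

-- Sums.  h = ⊕_{i : Fin m} sub h (S i).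

record IsSum (h : HG) (m : ℕ) (S : Fin m → Fin (n h) → Bool) : Set where
  field
    hoff     : IsHoffman h
    pieces   : ∀ i → IsHoffman (sub h (S i))
    cover    : ∀ v → ∃ λ i → S i v ≡ true
    slimIn   : ∀ x → fat h x ≡ false → ∃ λ i → S i x ≡ true
    slimUniq : ∀ x → fat h x ≡ false → ∀ i j → S i x ≡ true → S j x ≡ true → i ≡ j
    fatNbrs  : ∀ i x f → S i x ≡ true → fat h x ≡ false → fat h f ≡ true →
               adj h x f ≡ true → S i f ≡ true
    cross≤1  : ∀ i j → i ≢ j → ∀ x y → S i x ≡ true → S j y ≡ true →
               fat h x ≡ false → fat h y ≡ false → commonFat h x y ≤ 1
    cross≡1⇒ : ∀ i j → i ≢ j → ∀ x y → S i x ≡ true → S j y ≡ true →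
               fat h x ≡ false → fat h y ≡ false →
               commonFat h x y ≡ 1 → adj h x y ≡ true
    cross⇐   : ∀ i j → i ≢ j → ∀ x y → S i x ≡ true → S j y ≡ true →
               fat h x ≡ false → fat h y ≡ false →
               adj h x y ≡ true → commonFat h x y ≡ 1

IsFSum : (HG → Set) → (h : HG) → (m : ℕ) → (Fin m → Fin (n h) → Bool) → Set
IsFSum F h m S = IsSum h m S × (∀ i → sub h (S i) ∈ᶠ F)

Indecomposable : HG → Set
Indecomposable h = ¬ (Σ (Fin 2 → Fin (n h) → Bool) λ S →
                       IsSum h 2 S × (∀ i → ∃ λ v → S i v ≡ true))

FatHG : HG → Set
FatHG h = ∀ x → fat h x ≡ false → ∃ λ f → fat h f ≡ true × adj h x f ≡ true

h₁ : HG
h₁ = record { n = 2 ; adj = a ; fat = f }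
  where
  a : Fin 2 → Fin 2 → Bool
  a zero (suc zero) = true
  a (suc zero) zero = true
  a _ _ = false
  f : Fin 2 → Bool
  f zero = false
  f (suc zero) = true

h₂ : HG
h₂ = record { n = 3 ; adj = a ; fat = f }
  where
  a : Fin 3 → Fin 3 → Bool
  a zero (suc _) = true
  a (suc _) zero = true
  a _ _ = false
  f : Fin 3 → Bool
  f zero = false
  f (suc _) = true

𝒪 : HG → Set
𝒪 g = Iso h₂ g ⊎
      (IsHoffman g × Indecomposable g × FatHG g × 2 ≤ numSlim g × numFat g ≡ 1)

_⊆𝒪 : (HG → Set) → Set
F ⊆𝒪 = ∀ g → F g → g ∈ᶠ 𝒪

bar : (HG → Set) → HG → Set
bar F g = Iso h₂ g ⊎ (g ∈ᶠ 𝒪 × ∃ λ g' → F g' × Emb g g')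

closure : (h : HG) → (Fin (n h) → Bool) → Fin (n h) → Bool
closure h X v = X v ∨ (fat h v ∧ any (λ x → X x ∧ adj h x v) (allFin (n h)))

⟪_⟫ : {h : HG} → (Fin (n h) → Bool) → HG
⟪_⟫ {h} X = sub h (closure h X)

TildeDecomp : (𝔫 : HG) → (p q : ℕ) → (Fin (p + q) → Fin (n 𝔫) → Bool) → Set
TildeDecomp 𝔫 p q S =
  IsSum 𝔫 (p + q) S ×
  (∀ j → Iso h₁ (sub 𝔫 (S (j ↑ˡ q)))) ×
  (∀ j → sub 𝔫 (S (p ↑ʳ j)) ∈ᶠ 𝒪)

-- new fat vertex f_j (j : Fin p) adjacent exactly to the slim vertex of piece j
tilde : (𝔫 : HG) → (p q : ℕ) → (Fin (p + q) → Fin (n 𝔫) → Bool) → HG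
tilde 𝔫 p q S = record { n = n 𝔫 + p ; adj = a ; fat = f }
  where
  new : Fin (n 𝔫) → Fin p → Bool
  new x j = not (fat 𝔫 x) ∧ S (j ↑ˡ q) x
  a : Fin (n 𝔫 + p) → Fin (n 𝔫 + p) → Bool
  a u v with splitAt (n 𝔫) u | splitAt (n 𝔫) v
  ... | inj₁ x | inj₁ y = adj 𝔫 x y
  ... | inj₁ x | inj₂ j = new x j
  ... | inj₂ j | inj₁ x = new x j
  ... | inj₂ _ | inj₂ _ = false
  f : Fin (n 𝔫 + p) → Bool
  f u with splitAt (n 𝔫) u
  ... | inj₁ x = fat 𝔫 x
  ... | inj₂ _ = true

StrictCover : (HG → Set) → HG → HG → Set
StrictCover F g c =
  (∃ λ m → Σ (Fin m → Fin (n c) → Bool) λ S → IsFSum F c m S) ×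
  Σ (Emb g c) λ e → ∀ y → fat c y ≡ false → ∃ λ x → ι e x ≡ y

SlimLine : (HG → Set) → HG → Set
SlimLine F g =
  IsHoffman g × (∀ v → fat g v ≡ false) ×
  (∃ λ h → ∃ λ m → Σ (Fin m → Fin (n h) → Bool) λ S → IsFSum F h m S × Emb g h)

module Submission where

-- Call two slim vertices of N linked if they
-- are non-adjacent and share a fat neighbour.  The pieces of N are the connected
-- components of this relation (module Components) with their fat neighbours;
-- condition (iv) holds because a common fat neighbour of non-adjacent vertices
-- would link them.  A component with one vertex and one fat neighbour is h₁.  A
-- one-vertex component otherwise lies in an h₂-piece of 𝔥 and is h₂.  A larger
-- component lies in a one-fat piece of 𝔥 (module SumOf𝒪), so it has a single fat
-- vertex, and it is indecomposable since linked vertices never separate in a sum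
-- (module SumFacts).
--
-- Cover (module Tilde, tilde-strictCover).  Ñ is again a sum: its new pieces are
-- copies of h₂ and its old pieces are members of 𝒪 embedded in 𝔥, which lie in
-- ℋ̄ because an indecomposable one-fat graph embedded in 𝔥 stays inside one piece
-- (SumOf𝒪.oneFat-inPiece).  Its slim vertices are exactly X.
--
-- Slim line graphs: apply both parts to the image of the embedding.

open import Defs
open import Data.Nat using (ℕ; zero; suc; _+_; _≤_; z≤n; s≤s; _≡ᵇ_)
open import Data.Nat.Properties using (≡ᵇ⇒≡; ≡⇒≡ᵇ)
open import Data.Bool using (Bool; true; false; _∧_; _∨_; not; if_then_else_)
open import Data.Bool.Properties using (T-≡)
open import Data.Bool.ListAction using (any)
open import Data.Fin using (Fin; zero; suc; _≟_; splitAt; _↑ˡ_; _↑ʳ_)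
open import Data.Fin.Properties using (splitAt-↑ˡ; splitAt-↑ʳ; splitAt⁻¹-↑ˡ; splitAt⁻¹-↑ʳ; ↑ˡ-injective)
open import Data.List using (List; []; _∷_; length; filterᵇ; lookup; foldl; allFin)
open import Data.List.Membership.Propositional using (_∈_)
open import Data.List.Membership.Propositional.Properties using (∈-filter⁺; ∈-lookup; ∈-allFin)
open import Data.List.Relation.Unary.All as All using (All; []; _∷_)
open import Data.List.Relation.Unary.All.Properties using (all-filter)
open import Data.List.Relation.Unary.Any as Any using (here; there)
open import Data.List.Relation.Unary.Any.Properties using (lookup-index; any⁺; any⁻)
open import Data.List.Relation.Unary.Unique.Propositional using (Unique)
open import Data.List.Relation.Unary.Unique.Propositional.Properties using (allFin⁺) renaming (filter⁺ to unique-filter⁺)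
open import Data.List.Relation.Unary.AllPairs using ([]; _∷_)
open import Data.Product using (Σ; ∃; _×_; _,_; proj₁; proj₂)
open import Data.Sum using (_⊎_; inj₁; inj₂; [_,_]′)
open import Data.Empty using (⊥; ⊥-elim)
open import Function using (_∘_; Equivalence)
open import Relation.Nullary using (¬_; does; yes; no)
open import Relation.Nullary.Decidable.Core using (T?)
open import Relation.Binary.PropositionalEquality

true≢false : ¬ true ≡ false
true≢false ()

∧-true₁ : ∀ {a b} → a ∧ b ≡ true → a ≡ true
∧-true₁ {true} _ = refl

∧-true₂ : ∀ {a b} → a ∧ b ≡ true → b ≡ true
∧-true₂ {true} e = e

∧-intro : ∀ {a b} → a ≡ true → b ≡ true → a ∧ b ≡ true
∧-intro refl refl = refl

∨-elim : ∀ {a b} → a ∨ b ≡ true → a ≡ true ⊎ b ≡ true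
∨-elim {true} _ = inj₁ refl
∨-elim {false} e = inj₂ e

∨-intro₁ : ∀ {a b} → a ≡ true → a ∨ b ≡ true
∨-intro₁ refl = refl

∨-intro₂ : ∀ {a b} → b ≡ true → a ∨ b ≡ true
∨-intro₂ {true} _ = refl
∨-intro₂ {false} e = e

not-true : ∀ {a} → not a ≡ true → a ≡ false
not-true {false} _ = refl

not-false : ∀ {a} → a ≡ false → not a ≡ true
not-false refl = refl

fat-slim : ∀ {a} → a ≡ true → a ≡ false → ⊥
fat-slim refl ()

eqF : ∀ {m} → Fin m → Fin m → Bool
eqF x y = does (x ≟ y)

eqF-sound : ∀ {m} {x y : Fin m} → eqF x y ≡ true → x ≡ y
eqF-sound {x = x} {y} e with x ≟ y
... | yes x≡y = x≡y
... | no _ = ⊥-elim (true≢false (sym e))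

eqF-refl : ∀ {m} (x : Fin m) → eqF x x ≡ true
eqF-refl x with x ≟ x
... | yes _ = refl
... | no x≢x = ⊥-elim (x≢x refl)

eqF-complete : ∀ {m} {x y : Fin m} → x ≡ y → eqF x y ≡ true
eqF-complete {x = x} refl = eqF-refl x

↑ˡ≢↑ʳ : ∀ {a b} {A : Set} (x : Fin a) (j : Fin b) → x ↑ˡ b ≡ a ↑ʳ j → A
↑ˡ≢↑ʳ {a} {b} x j e with trans (sym (splitAt-↑ˡ a x b)) (trans (cong (splitAt a) e) (splitAt-↑ʳ a b j))
... | ()

any-allFin⁺ : ∀ {m} (p : Fin m → Bool) x → p x ≡ true → any p (allFin m) ≡ true
any-allFin⁺ p x px = Equivalence.to T-≡ (any⁺ p (Any.map (λ { refl → Equivalence.from T-≡ px }) (∈-allFin x)))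

any-allFin⁻ : ∀ {m} (p : Fin m → Bool) → any p (allFin m) ≡ true → ∃ λ x → p x ≡ true
any-allFin⁻ {m} p e =
  let (x , px) = Any.satisfied (any⁻ p (allFin m) (Equivalence.from T-≡ e)) in x , Equivalence.to T-≡ px

lookup-injective : ∀ {A : Set} {xs : List A} → Unique xs → ∀ i j → lookup xs i ≡ lookup xs j → i ≡ j
lookup-injective (_ ∷ _) zero zero _ = refl
lookup-injective (x≢ ∷ _) zero (suc j) e = ⊥-elim (All.lookup x≢ (∈-lookup j) e)
lookup-injective (x≢ ∷ _) (suc i) zero e = ⊥-elim (All.lookup x≢ (∈-lookup i) (sym e))
lookup-injective (_ ∷ u) (suc i) (suc j) e = cong suc (lookup-injective u i j e)

module _ {m : ℕ} (P : Fin m → Bool) where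

  select : List (Fin m)
  select = filterᵇ P (allFin m)

  select-unique : Unique select
  select-unique = unique-filter⁺ (T? ∘ P) (allFin⁺ m)

  select-sound : All (λ x → P x ≡ true) select
  select-sound = All.map (Equivalence.to T-≡) (all-filter (T? ∘ P) (allFin m))

  select-complete : ∀ x → P x ≡ true → x ∈ select
  select-complete x px = ∈-filter⁺ (T? ∘ P) (∈-allFin x) (Equivalence.from T-≡ px)

AtMost1 : ∀ {m} → (Fin m → Bool) → Set
AtMost1 P = ∀ a b → P a ≡ true → P b ≡ true → a ≡ b

count≤1⇒atMost1 : ∀ {m} (P : Fin m → Bool) → count P ≤ 1 → AtMost1 P
count≤1⇒atMost1 P le a b pa pb = go (select P) le (select-complete P a pa) (select-complete P b pb)
  where
  go : ∀ xs → length xs ≤ 1 → a ∈ xs → b ∈ xs → a ≡ b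
  go (_ ∷ []) _ (here a≡x) (here b≡x) = trans a≡x (sym b≡x)
  go (_ ∷ _ ∷ _) (s≤s ()) _ _

atMost1⇒count≤1 : ∀ {m} (P : Fin m → Bool) → AtMost1 P → count P ≤ 1
atMost1⇒count≤1 P am = go (select P) (select-unique P) (select-sound P)
  where
  go : ∀ xs → Unique xs → All (λ x → P x ≡ true) xs → length xs ≤ 1
  go [] _ _ = z≤n
  go (_ ∷ []) _ _ = s≤s z≤n
  go (x ∷ y ∷ _) ((x≢y ∷ _) ∷ _) (px ∷ py ∷ _) = ⊥-elim (x≢y (am x y px py))

count≡1⇒atMost1 : ∀ {m} (P : Fin m → Bool) → count P ≡ 1 → AtMost1 P
count≡1⇒atMost1 P e = count≤1⇒atMost1 P (subst (_≤ 1) (sym e) (s≤s z≤n))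

count≡1⇒witness : ∀ {m} (P : Fin m → Bool) → count P ≡ 1 → ∃ λ a → P a ≡ true
count≡1⇒witness P e = go (select P) e (select-sound P)
  where
  go : ∀ xs → length xs ≡ 1 → All (λ x → P x ≡ true) xs → ∃ λ a → P a ≡ true
  go (x ∷ _) _ (px ∷ _) = x , px

count-nonzero : ∀ {m} (P : Fin m → Bool) x → P x ≡ true → ¬ count P ≡ 0
count-nonzero P x px with select P | select-complete P x px
... | _ ∷ _ | _ = λ ()

count≡1 : ∀ {m} (P : Fin m → Bool) a → P a ≡ true → AtMost1 P → count P ≡ 1
count≡1 P a pa am with select P | select-complete P a pa | atMost1⇒count≤1 P am
... | _ ∷ [] | _ | _ = refl
... | _ ∷ _ ∷ _ | _ | s≤s ()

count≥2 : ∀ {m} (P : Fin m → Bool) a b → P a ≡ true → P b ≡ true → ¬ a ≡ b → 2 ≤ count P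
count≥2 P a b pa pb a≢b with select P | select-complete P a pa | count≤1⇒atMost1 P
... | _ ∷ _ ∷ _ | _ | _ = s≤s (s≤s z≤n)
... | _ ∷ [] | _ | atMost1 = ⊥-elim (a≢b (atMost1 (s≤s z≤n) a b pa pb))

count≥2⇒two : ∀ {m} (P : Fin m → Bool) → 2 ≤ count P →
  ∃ λ a → ∃ λ b → P a ≡ true × P b ≡ true × ¬ a ≡ b
count≥2⇒two P le = go (select P) le (select-unique P) (select-sound P)
  where
  go : ∀ xs → 2 ≤ length xs → Unique xs → All (λ x → P x ≡ true) xs →
       ∃ λ a → ∃ λ b → P a ≡ true × P b ≡ true × ¬ a ≡ b
  go (_ ∷ []) (s≤s ()) _ _
  go (x ∷ y ∷ _) _ ((x≢y ∷ _) ∷ _) (px ∷ py ∷ _) = x , y , px , py , x≢y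

-- Induced subgraphs.  The vertices of `sub h P` are the positions in `select P`;
-- `incl` sends them back to h, and `pre` finds the position of a vertex of P.

module _ (h : HG) (P : Fin (n h) → Bool) where

  incl : Fin (n (sub h P)) → Fin (n h)
  incl = lookup (subV h P)

  incl-mem : ∀ u → P (incl u) ≡ true
  incl-mem u = All.lookup (select-sound P) (∈-lookup u)

  incl-inj : ∀ u w → incl u ≡ incl w → u ≡ w
  incl-inj = lookup-injective (select-unique P)

  pre : ∀ v → P v ≡ true → Fin (n (sub h P))
  pre v pv = Any.index (select-complete P v pv)

  incl-pre : ∀ v (pv : P v ≡ true) → incl (pre v pv) ≡ v
  incl-pre v pv = sym (lookup-index (select-complete P v pv))

  pre-unique : ∀ u v (pv : P v ≡ true) → incl u ≡ v → u ≡ pre v pv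
  pre-unique u v pv e = incl-inj u (pre v pv) (trans e (sym (incl-pre v pv)))

  inclEmb : Emb (sub h P) h
  inclEmb = record { ι = incl ; inj = incl-inj ; adjP = λ _ _ → refl ; fatP = λ _ → refl }

  corestrict : ∀ {a} (e : Emb a h) → (∀ u → P (ι e u) ≡ true) → Emb a (sub h P)
  corestrict {a} e inP = record
    { ι = λ u → pre (ι e u) (inP u)
    ; inj = λ u w x → inj e u w (trans (sym (back u)) (trans (cong incl x) (back w)))
    ; adjP = λ u w → trans (cong₂ (adj h) (back u) (back w)) (adjP e u w)
    ; fatP = λ u → trans (cong (fat h) (back u)) (fatP e u)
    }
    where
    back : ∀ u → incl (pre (ι e u) (inP u)) ≡ ι e u
    back u = incl-pre (ι e u) (inP u)

  incl-corestrict : ∀ {a} (e : Emb a h) (inP : ∀ u → P (ι e u) ≡ true) → ∀ u → incl (ι (corestrict e inP) u) ≡ ι e u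
  incl-corestrict e inP u = incl-pre (ι e u) (inP u)

  subHoffman : IsHoffman h →
    (∀ f → P f ≡ true → fat h f ≡ true → ∃ λ x → P x ≡ true × fat h x ≡ false × adj h x f ≡ true) →
    IsHoffman (sub h P)
  subHoffman H slimNbr = record
    { sym = λ u v → IsHoffman.sym H (incl u) (incl v)
    ; irr = λ u → IsHoffman.irr H (incl u)
    ; fatNA = λ u v → IsHoffman.fatNA H (incl u) (incl v)
    ; fatSl = λ f ff →
        let (x , px , fx , ax) = slimNbr (incl f) (incl-mem f) ff in
        pre x px , trans (cong (fat h) (incl-pre x px)) fx , trans (cong (λ z → adj h z (incl f)) (incl-pre x px)) ax
    }

  subSlimNbr : IsHoffman (sub h P) → ∀ f → P f ≡ true → fat h f ≡ true →
    ∃ λ x → P x ≡ true × fat h x ≡ false × adj h x f ≡ true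
  subSlimNbr H f pf ff =
    let e = incl-pre f pf
        (x , fx , ax) = IsHoffman.fatSl H (pre f pf) (trans (cong (fat h) e) ff) in
    incl x , incl-mem x , fx , trans (cong (adj h (incl x)) (sym e)) ax

idEmb : (g : HG) → Emb g g
idEmb g = record { ι = λ u → u ; inj = λ _ _ e → e ; adjP = λ _ _ → refl ; fatP = λ _ → refl }

_∘E_ : ∀ {a b c} → Emb b c → Emb a b → Emb a c
f ∘E e = record
  { ι = λ u → ι f (ι e u)
  ; inj = λ u v x → inj e u v (inj f _ _ x)
  ; adjP = λ u v → trans (adjP f (ι e u) (ι e v)) (adjP e u v)
  ; fatP = λ u → trans (fatP f (ι e u)) (fatP e u)
  }

isoRefl : (g : HG) → Iso g g
isoRefl g = idEmb g , λ y → y , refl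

isoTrans : ∀ {a b c} → Iso b c → Iso a b → Iso a c
isoTrans (f , onto-f) (e , onto-e) = (f ∘E e) , λ y →
  let (x , ex) = onto-f y ; (w , ew) = onto-e x in w , trans (cong (ι f) ew) ex

isoSym : ∀ {a b} → Iso a b → Iso b a
isoSym {a} {b} (e , onto) = inv , λ x → ι e x , inj e _ _ (proj₂ (onto (ι e x)))
  where
  back : Fin (n b) → Fin (n a)
  back y = proj₁ (onto y)
  section : ∀ y → ι e (back y) ≡ y
  section y = proj₂ (onto y)
  inv : Emb b a
  inv = record
    { ι = back
    ; inj = λ u v x → trans (sym (section u)) (trans (cong (ι e) x) (section v))
    ; adjP = λ u v → trans (sym (adjP e (back u) (back v))) (cong₂ (adj b) (section u) (section v))
    ; fatP = λ u → trans (sym (fatP e (back u))) (cong (fat b) (section u))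
    }

slim≢fat : ∀ {g : HG} {s f} → fat g s ≡ false → fat g f ≡ true → ¬ s ≡ f
slim≢fat fs ff refl = fat-slim ff fs

h₁-iso : (g : HG) → IsHoffman g → (s f : Fin (n g)) → fat g s ≡ false → fat g f ≡ true →
         adj g s f ≡ true → (∀ v → v ≡ s ⊎ v ≡ f) → Iso h₁ g
h₁-iso g H s f fs ff asf onlySF = e , onto
  where
  s≢f : ¬ s ≡ f
  s≢f = slim≢fat {g} fs ff
  e : Emb h₁ g
  e = record
    { ι = λ { zero → s ; (suc zero) → f }
    ; inj = λ { zero zero _ → refl ; zero (suc zero) x → ⊥-elim (s≢f x)
              ; (suc zero) zero x → ⊥-elim (s≢f (sym x)) ; (suc zero) (suc zero) _ → refl }
    ; adjP = λ { zero zero → IsHoffman.irr H s ; zero (suc zero) → asf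
               ; (suc zero) zero → trans (IsHoffman.sym H f s) asf ; (suc zero) (suc zero) → IsHoffman.irr H f }
    ; fatP = λ { zero → fs ; (suc zero) → ff }
    }
  onto : ∀ y → ∃ λ x → ι e x ≡ y
  onto y with onlySF y
  ... | inj₁ y≡s = zero , sym y≡s
  ... | inj₂ y≡f = suc zero , sym y≡f

h₁-shape : (g : HG) → Iso h₁ g → Σ (Fin (n g)) λ s → Σ (Fin (n g)) λ f →
           fat g s ≡ false × fat g f ≡ true × adj g s f ≡ true × (∀ v → v ≡ s ⊎ v ≡ f)
h₁-shape g (e , onto) = ι e zero , ι e (suc zero) , fatP e zero , fatP e (suc zero) , adjP e zero (suc zero) , onlySF
  where
  onlySF : ∀ v → v ≡ ι e zero ⊎ v ≡ ι e (suc zero)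
  onlySF v with onto v
  ... | zero , x = inj₁ (sym x)
  ... | suc zero , x = inj₂ (sym x)

h₂-iso : (g : HG) → IsHoffman g → (s f₁ f₂ : Fin (n g)) → fat g s ≡ false → fat g f₁ ≡ true → fat g f₂ ≡ true →
         ¬ f₁ ≡ f₂ → adj g s f₁ ≡ true → adj g s f₂ ≡ true → (∀ v → v ≡ s ⊎ v ≡ f₁ ⊎ v ≡ f₂) → Iso h₂ g
h₂-iso g H s f₁ f₂ fs ff₁ ff₂ f₁≢f₂ a₁ a₂ onlySF = e , onto
  where
  vertex : Fin 3 → Fin (n g)
  vertex zero = s
  vertex (suc zero) = f₁
  vertex (suc (suc zero)) = f₂
  s≢f₁ : ¬ s ≡ f₁
  s≢f₁ = slim≢fat {g} fs ff₁
  s≢f₂ : ¬ s ≡ f₂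
  s≢f₂ = slim≢fat {g} fs ff₂
  vertex-inj : ∀ u v → vertex u ≡ vertex v → u ≡ v
  vertex-inj zero zero _ = refl
  vertex-inj zero (suc zero) x = ⊥-elim (s≢f₁ x)
  vertex-inj zero (suc (suc zero)) x = ⊥-elim (s≢f₂ x)
  vertex-inj (suc zero) zero x = ⊥-elim (s≢f₁ (sym x))
  vertex-inj (suc zero) (suc zero) _ = refl
  vertex-inj (suc zero) (suc (suc zero)) x = ⊥-elim (f₁≢f₂ x)
  vertex-inj (suc (suc zero)) zero x = ⊥-elim (s≢f₂ (sym x))
  vertex-inj (suc (suc zero)) (suc zero) x = ⊥-elim (f₁≢f₂ (sym x))
  vertex-inj (suc (suc zero)) (suc (suc zero)) _ = refl
  vertex-adj : ∀ u v → adj g (vertex u) (vertex v) ≡ adj h₂ u v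
  vertex-adj zero zero = IsHoffman.irr H s
  vertex-adj zero (suc zero) = a₁
  vertex-adj zero (suc (suc zero)) = a₂
  vertex-adj (suc zero) zero = trans (IsHoffman.sym H f₁ s) a₁
  vertex-adj (suc zero) (suc zero) = IsHoffman.irr H f₁
  vertex-adj (suc zero) (suc (suc zero)) = IsHoffman.fatNA H f₁ f₂ ff₁ ff₂
  vertex-adj (suc (suc zero)) zero = trans (IsHoffman.sym H f₂ s) a₂
  vertex-adj (suc (suc zero)) (suc zero) = IsHoffman.fatNA H f₂ f₁ ff₂ ff₁
  vertex-adj (suc (suc zero)) (suc (suc zero)) = IsHoffman.irr H f₂
  e : Emb h₂ g
  e = record
    { ι = vertex
    ; inj = vertex-inj
    ; adjP = vertex-adj
    ; fatP = λ { zero → fs ; (suc zero) → ff₁ ; (suc (suc zero)) → ff₂ }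
    }
  onto : ∀ y → ∃ λ x → vertex x ≡ y
  onto y with onlySF y
  ... | inj₁ x = zero , sym x
  ... | inj₂ (inj₁ x) = suc zero , sym x
  ... | inj₂ (inj₂ x) = suc (suc zero) , sym x

-- A labelling
-- is computed by union–find style relabelling over all pairs; two vertices get
-- the same label exactly when they are joined by an E-path.

module Components {k : ℕ} (E : Fin k → Fin k → Bool) (E-sym : ∀ u w → E u w ≡ true → E w u ≡ true) where

  data Path : Fin k → Fin k → Set where
    here : ∀ {z} → Path z z
    step : ∀ {z w v} → E z w ≡ true → Path w v → Path z v

  path-trans : ∀ {a b c} → Path a b → Path b c → Path a c
  path-trans here q = q
  path-trans (step e p) q = step e (path-trans p q)

  path-sym : ∀ {a b} → Path a b → Path b a
  path-sym here = here
  path-sym (step {z} {w} e p) = path-trans (path-sym p) (step (E-sym z w e) here)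

  Labelling : Set
  Labelling = Fin k → Fin k

  merge : Labelling → Fin k → Fin k → Labelling
  merge L x y z = if E x y ∧ eqF (L z) (L y) then L x else L z

  Sound : Labelling → Set
  Sound L = ∀ z w → L z ≡ L w → Path z w

  merge-sound : ∀ L x y → Sound L → Sound (merge L x y)
  merge-sound L x y sound z w e with E x y in exy
  ... | false = sound z w e
  ... | true with eqF (L z) (L y) in ez | eqF (L w) (L y) in ew
  ...   | true | true = path-trans (sound z y (eqF-sound ez)) (path-sym (sound w y (eqF-sound ew)))
  ...   | true | false = path-trans (sound z y (eqF-sound ez)) (step (E-sym x y exy) (sound x w e))
  ...   | false | true = path-trans (sound z x e) (step exy (path-sym (sound w y (eqF-sound ew))))
  ...   | false | false = sound z w e

  merge-keeps : ∀ L x y z w → L z ≡ L w → merge L x y z ≡ merge L x y w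
  merge-keeps L x y z w e = cong (λ a → if E x y ∧ eqF a (L y) then L x else a) e

  merge-joins : ∀ L x y → E x y ≡ true → merge L x y x ≡ merge L x y y
  merge-joins L x y exy rewrite exy | eqF-refl (L y) with eqF (L x) (L y)
  ... | true = refl
  ... | false = refl

  processRow : Labelling → Fin k → Labelling
  processRow L x = foldl (λ L' y → merge L' x y) L (allFin k)

  component : Labelling
  component = foldl processRow (λ z → z) (allFin k)

  foldl-preserves : ∀ {A B : Set} (Inv : A → Set) (f : A → B → A) → (∀ a b → Inv a → Inv (f a b)) →
    ∀ xs a → Inv a → Inv (foldl f a xs)
  foldl-preserves Inv f pres [] a inv = inv
  foldl-preserves Inv f pres (b ∷ xs) a inv = foldl-preserves Inv f pres xs (f a b) (pres a b inv)

  foldl-establishes : ∀ {A B : Set} (Inv : A → Set) (f : A → B → A) → (∀ a b → Inv a → Inv (f a b)) →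
    ∀ b₀ → (∀ a → Inv (f a b₀)) → ∀ xs → b₀ ∈ xs → ∀ a → Inv (foldl f a xs)
  foldl-establishes Inv f pres b₀ est (b ∷ xs) (here refl) a = foldl-preserves Inv f pres xs (f a b) (est a)
  foldl-establishes Inv f pres b₀ est (b ∷ xs) (there m) a = foldl-establishes Inv f pres b₀ est xs m (f a b)

  component-path : ∀ z w → component z ≡ component w → Path z w
  component-path = foldl-preserves Sound processRow
    (λ L x → foldl-preserves Sound (λ L' y → merge L' x y) (λ L' y → merge-sound L' x y) (allFin k) L)
    (allFin k) (λ z → z) (λ z w e → subst (Path z) e here)

  edge-component : ∀ x y → E x y ≡ true → component x ≡ component y
  edge-component x y exy =
    foldl-establishes SameLabel processRow (λ L x' → keepsRow L x') x joinsRow (allFin k) (∈-allFin x) (λ z → z)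
    where
    SameLabel : Labelling → Set
    SameLabel L = L x ≡ L y
    keepsRow : ∀ L x' → SameLabel L → SameLabel (processRow L x')
    keepsRow L x' = foldl-preserves SameLabel (λ L' y' → merge L' x' y') (λ L' y' → merge-keeps L' x' y' x y) (allFin k) L
    joinsRow : ∀ L → SameLabel (processRow L x)
    joinsRow L = foldl-establishes SameLabel (λ L' y' → merge L' x y') (λ L' y' → merge-keeps L' x y' x y) y
      (λ L' → merge-joins L' x y exy) (allFin k) (∈-allFin y) L

  path-component : ∀ {z w} → Path z w → component z ≡ component w
  path-component here = refl
  path-component (step {z} {w'} e p) = trans (edge-component z w' e) (path-component p)

CommonFat : (h : HG) → Fin (n h) → Fin (n h) → Fin (n h) → Bool
CommonFat h x y f = fat h f ∧ (adj h x f ∧ adj h y f)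

commonFat-intro : (h : HG) {x y f : Fin (n h)} → fat h f ≡ true → adj h x f ≡ true → adj h y f ≡ true →
  CommonFat h x y f ≡ true
commonFat-intro h ff xf yf = ∧-intro ff (∧-intro xf yf)

commonFat-elim : (h : HG) {x y f : Fin (n h)} → CommonFat h x y f ≡ true →
  fat h f ≡ true × adj h x f ≡ true × adj h y f ≡ true
commonFat-elim h {x} {y} {f} e = ∧-true₁ e , ∧-true₁ (∧-true₂ {fat h f} e) , ∧-true₂ {adj h x f} (∧-true₂ {fat h f} e)

commonFat-sym : (h : HG) {x y f : Fin (n h)} → CommonFat h x y f ≡ true → CommonFat h y x f ≡ true
commonFat-sym h e = let (ff , xf , yf) = commonFat-elim h e in commonFat-intro h ff yf xf

module OneFat (g : HG) (H : IsHoffman g) (fatg : FatHG g) (one : numFat g ≡ 1) where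

  φ : Fin (n g)
  φ = proj₁ (count≡1⇒witness (fat g) one)

  φ-fat : fat g φ ≡ true
  φ-fat = proj₂ (count≡1⇒witness (fat g) one)

  φ-unique : ∀ u → fat g u ≡ true → u ≡ φ
  φ-unique u fu = count≡1⇒atMost1 (fat g) one u φ fu φ-fat

  φ-adj : ∀ u → fat g u ≡ false → adj g u φ ≡ true
  φ-adj u fu = let (f , ff , af) = fatg u fu in subst (λ z → adj g u z ≡ true) (φ-unique f ff) af

  commonFat≡1 : ∀ x y → fat g x ≡ false → fat g y ≡ false → commonFat g x y ≡ 1
  commonFat≡1 x y fx fy = count≡1 (CommonFat g x y) φ (commonFat-intro g φ-fat (φ-adj x fx) (φ-adj y fy))
    (λ a b ca cb → trans (φ-unique a (∧-true₁ ca)) (sym (φ-unique b (∧-true₁ cb))))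

  -- If a Boolean predicate Q splits the slim vertices into two non-empty sides
  -- with every slim vertex of one side adjacent to every slim vertex of the
  -- other, then g is the sum of the two sides (each side together with φ).
  split : (Q : Fin (n g) → Bool) →
    (∀ x y → fat g x ≡ false → fat g y ≡ false → Q x ≡ true → Q y ≡ false → adj g x y ≡ true) →
    ∀ a b → fat g a ≡ false → fat g b ≡ false → Q a ≡ true → Q b ≡ false → ¬ Indecomposable g
  split Q across a b fa fb qa qb indec = indec (side , isSum , nonEmpty)
    where
    side : Fin 2 → Fin (n g) → Bool
    side zero w = fat g w ∨ Q w
    side (suc zero) w = fat g w ∨ not (Q w)

    side₀ : ∀ w → side zero w ≡ true → fat g w ≡ false → Q w ≡ true
    side₀ w sw fw rewrite fw = sw
    side₁ : ∀ w → side (suc zero) w ≡ true → fat g w ≡ false → Q w ≡ false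
    side₁ w sw fw rewrite fw = not-true sw

    fatBoth : ∀ i w → fat g w ≡ true → side i w ≡ true
    fatBoth zero w fw rewrite fw = refl
    fatBoth (suc zero) w fw rewrite fw = refl

    slimSide : ∀ w → fat g w ≡ false → ∃ λ i → side i w ≡ true
    slimSide w fw with Q w in qw
    ... | true = zero , ∨-intro₂ {fat g w} qw
    ... | false = suc zero , ∨-intro₂ {fat g w} (not-false qw)

    witness : ∀ i → ∃ λ x → side i x ≡ true × fat g x ≡ false
    witness zero = a , ∨-intro₂ {fat g a} qa , fa
    witness (suc zero) = b , ∨-intro₂ {fat g b} (not-false qb) , fb

    nonEmpty : ∀ i → ∃ λ v → side i v ≡ true
    nonEmpty i = let (x , sx , _) = witness i in x , sx

    slimNbr : ∀ i f → fat g f ≡ true → ∃ λ x → side i x ≡ true × fat g x ≡ false × adj g x f ≡ true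
    slimNbr i f ff = let (x , sx , fx) = witness i in
      x , sx , fx , subst (λ z → adj g x z ≡ true) (sym (φ-unique f ff)) (φ-adj x fx)

    isSum : IsSum g 2 side
    isSum = record
      { hoff = H
      ; pieces = λ i → subHoffman g (side i) H (λ f _ ff → slimNbr i f ff)
      ; cover = λ w → case-fat w (fat g w) refl
      ; slimIn = slimSide
      ; slimUniq = λ { x fx zero zero _ _ → refl
                     ; x fx zero (suc zero) s₀ s₁ → ⊥-elim (true≢false (trans (sym (side₀ x s₀ fx)) (side₁ x s₁ fx)))
                     ; x fx (suc zero) zero s₁ s₀ → ⊥-elim (true≢false (trans (sym (side₀ x s₀ fx)) (side₁ x s₁ fx)))
                     ; x fx (suc zero) (suc zero) _ _ → refl }
      ; fatNbrs = λ i _ f _ _ ff _ → fatBoth i f ff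
      ; cross≤1 = λ _ _ _ x y _ _ fx fy → subst (_≤ 1) (sym (commonFat≡1 x y fx fy)) (s≤s z≤n)
      ; cross≡1⇒ = λ { zero zero i≢j → ⊥-elim (i≢j refl)
                     ; (suc zero) (suc zero) i≢j → ⊥-elim (i≢j refl)
                     ; zero (suc zero) _ x y sx sy fx fy _ → across x y fx fy (side₀ x sx fx) (side₁ y sy fy)
                     ; (suc zero) zero _ x y sx sy fx fy _ →
                         trans (IsHoffman.sym H x y) (across y x fy fx (side₀ y sy fy) (side₁ x sx fx)) }
      ; cross⇐ = λ _ _ _ x y _ _ fx fy _ → commonFat≡1 x y fx fy
      }
      where
      case-fat : ∀ w b → fat g w ≡ b → ∃ λ i → side i w ≡ true
      case-fat w true fw = zero , fatBoth zero w fw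
      case-fat w false fw = slimSide w fw

module SumFacts {h : HG} {m : ℕ} {S : Fin m → Fin (n h) → Bool} (sum : IsSum h m S) where

  open IsSum sum using (slimIn; cross≤1; cross≡1⇒)

  differentPieces-adjacent : ∀ i j x y f → ¬ i ≡ j → S i x ≡ true → S j y ≡ true → fat h x ≡ false →
    fat h y ≡ false → CommonFat h x y f ≡ true → adj h x y ≡ true
  differentPieces-adjacent i j x y f i≢j sx sy fx fy cf =
    cross≡1⇒ i j i≢j x y sx sy fx fy
      (count≡1 (CommonFat h x y) f cf (count≤1⇒atMost1 (CommonFat h x y) (cross≤1 i j i≢j x y sx sy fx fy)))

  nonadjacent-samePiece : ∀ i x y f → S i x ≡ true → fat h x ≡ false → fat h y ≡ false →
    CommonFat h x y f ≡ true → adj h x y ≡ false → S i y ≡ true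
  nonadjacent-samePiece i x y f sx fx fy cf xy = byCases (S i y) refl
    where
    byCases : ∀ b → S i y ≡ b → S i y ≡ true
    byCases true e = e
    byCases false e =
      let (j , sy) = slimIn y fy
          i≢j : ¬ i ≡ j
          i≢j i≡j = true≢false (trans (sym (subst (λ k → S k y ≡ true) (sym i≡j) sy)) e) in
      ⊥-elim (true≢false (trans (sym (differentPieces-adjacent i j x y f i≢j sx sy fx fy cf)) xy))

module SumOf𝒪 (𝔥 : HG) (m : ℕ) (S : Fin m → Fin (n 𝔥) → Bool) (sum : IsSum 𝔥 m S)
              (in𝒪 : ∀ i → sub 𝔥 (S i) ∈ᶠ 𝒪) where

  open IsSum sum using (hoff; slimIn; fatNbrs; cross≤1; cross⇐)

  data PieceShape (i : Fin m) : Set where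
    twoFat : (s f₁ f₂ : Fin (n 𝔥)) → fat 𝔥 s ≡ false → fat 𝔥 f₁ ≡ true → fat 𝔥 f₂ ≡ true → ¬ f₁ ≡ f₂ →
             adj 𝔥 s f₁ ≡ true → adj 𝔥 s f₂ ≡ true → (∀ v → S i v ≡ true → v ≡ s ⊎ v ≡ f₁ ⊎ v ≡ f₂) →
             PieceShape i
    oneFat : (φ : Fin (n 𝔥)) → fat 𝔥 φ ≡ true → (∀ f → S i f ≡ true → fat 𝔥 f ≡ true → f ≡ φ) →
             (∀ x → S i x ≡ true → fat 𝔥 x ≡ false → adj 𝔥 x φ ≡ true) → PieceShape i

  fromCopy : ∀ {i g} (iso : Iso g (sub 𝔥 (S i))) v → S i v ≡ true → ∃ λ u → incl 𝔥 (S i) (ι (proj₁ iso) u) ≡ v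
  fromCopy {i} (e , onto) v sv =
    let (u , eu) = onto (pre 𝔥 (S i) v sv) in u , trans (cong (incl 𝔥 (S i)) eu) (incl-pre 𝔥 (S i) v sv)

  pieceShape : ∀ i → PieceShape i
  pieceShape i with in𝒪 i
  ... | g , inj₁ isoH₂ , iso = twoFat (vertex zero) (vertex (suc zero)) (vertex (suc (suc zero)))
        (fatP e zero) (fatP e (suc zero)) (fatP e (suc (suc zero))) (λ x → 1≢2 (inj e _ _ x))
        (adjP e zero (suc zero)) (adjP e zero (suc (suc zero))) onlyThree
    where
    iso′ = isoTrans iso isoH₂
    e : Emb h₂ 𝔥
    e = inclEmb 𝔥 (S i) ∘E proj₁ iso′
    vertex : Fin 3 → Fin (n 𝔥)
    vertex = ι e
    1≢2 : ¬ Fin.suc {2} zero ≡ suc (suc zero)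
    1≢2 ()
    onlyThree : ∀ v → S i v ≡ true → v ≡ vertex zero ⊎ v ≡ vertex (suc zero) ⊎ v ≡ vertex (suc (suc zero))
    onlyThree v sv with fromCopy iso′ v sv
    ... | zero , x = inj₁ (sym x)
    ... | suc zero , x = inj₂ (inj₁ (sym x))
    ... | suc (suc zero) , x = inj₂ (inj₂ (sym x))
  ... | g , inj₂ (Hg , _ , fatg , _ , one) , iso =
        oneFat (ι e φ) (trans (fatP e φ) φ-fat) onlyφ
          (λ x sx fx → let (u , eu) = fromCopy iso x sx in
             trans (cong (λ z → adj 𝔥 z (ι e φ)) (sym eu)) (trans (adjP e u φ) (φ-adj u (slimOf u eu fx))))
    where
    open OneFat g Hg fatg one
    e : Emb g 𝔥
    e = inclEmb 𝔥 (S i) ∘E proj₁ iso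
    slimOf : ∀ {b} u {v} → ι e u ≡ v → fat 𝔥 v ≡ b → fat g u ≡ b
    slimOf u eu fv = trans (sym (fatP e u)) (trans (cong (fat 𝔥) eu) fv)
    onlyφ : ∀ f → S i f ≡ true → fat 𝔥 f ≡ true → f ≡ ι e φ
    onlyφ f sf ff = let (u , eu) = fromCopy iso f sf in trans (sym eu) (cong (ι e) (φ-unique u (slimOf u eu ff)))

  pieceOf : ∀ x → fat 𝔥 x ≡ false → Fin m
  pieceOf x fx = proj₁ (slimIn x fx)

  pieceOf-mem : ∀ x fx → S (pieceOf x fx) x ≡ true
  pieceOf-mem x fx = proj₂ (slimIn x fx)

  otherPiece : ∀ i y fy → S i y ≡ false → ¬ i ≡ pieceOf y fy
  otherPiece i y fy sy i≡j = true≢false (trans (sym (subst (λ k → S k y ≡ true) (sym i≡j) (pieceOf-mem y fy))) sy)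

  samePiece-oneFat : ∀ i x y → S i x ≡ true → S i y ≡ true → fat 𝔥 x ≡ false → fat 𝔥 y ≡ false → ¬ x ≡ y →
    Σ (Fin (n 𝔥)) λ φ → fat 𝔥 φ ≡ true × (∀ f → S i f ≡ true → fat 𝔥 f ≡ true → f ≡ φ) ×
      (∀ z → S i z ≡ true → fat 𝔥 z ≡ false → adj 𝔥 z φ ≡ true)
  samePiece-oneFat i x y sx sy fx fy x≢y with pieceShape i
  ... | oneFat φ fφ onlyφ adjφ = φ , fφ , onlyφ , adjφ
  ... | twoFat s f₁ f₂ fs ff₁ ff₂ _ _ _ onlyThree = ⊥-elim (x≢y (trans (isS x sx fx) (sym (isS y sy fy))))
    where
    isS : ∀ z → S i z ≡ true → fat 𝔥 z ≡ false → z ≡ s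
    isS z sz fz with onlyThree z sz
    ... | inj₁ e = e
    ... | inj₂ (inj₁ refl) = ⊥-elim (fat-slim ff₁ fz)
    ... | inj₂ (inj₂ refl) = ⊥-elim (fat-slim ff₂ fz)

  commonFat-atMost1 : ∀ x y → fat 𝔥 x ≡ false → fat 𝔥 y ≡ false → ¬ x ≡ y → AtMost1 (CommonFat 𝔥 x y)
  commonFat-atMost1 x y fx fy x≢y with S (pieceOf x fx) y in sy
  ... | true = λ a b ca cb →
          let (φ , _ , onlyφ , _) = samePiece-oneFat i x y (pieceOf-mem x fx) sy fx fy x≢y
              (fa , xa , _) = commonFat-elim 𝔥 ca
              (fb , xb , _) = commonFat-elim 𝔥 cb in
          trans (onlyφ a (fatNbrs i x a (pieceOf-mem x fx) fx fa xa) fa)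
                (sym (onlyφ b (fatNbrs i x b (pieceOf-mem x fx) fx fb xb) fb))
    where i = pieceOf x fx
  ... | false = count≤1⇒atMost1 (CommonFat 𝔥 x y)
          (cross≤1 (pieceOf x fx) (pieceOf y fy) (otherPiece _ y fy sy) x y (pieceOf-mem x fx) (pieceOf-mem y fy) fx fy)

  adjacent-commonFat : ∀ x y → fat 𝔥 x ≡ false → fat 𝔥 y ≡ false → adj 𝔥 x y ≡ true →
    ∃ λ f → CommonFat 𝔥 x y f ≡ true
  adjacent-commonFat x y fx fy xy with S (pieceOf x fx) y in sy
  ... | true = let (φ , fφ , _ , adjφ) = samePiece-oneFat i x y (pieceOf-mem x fx) sy fx fy x≢y in
        φ , commonFat-intro 𝔥 fφ (adjφ x (pieceOf-mem x fx) fx) (adjφ y sy fy)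
    where
    i = pieceOf x fx
    x≢y : ¬ x ≡ y
    x≢y refl = true≢false (trans (sym xy) (IsHoffman.irr hoff x))
  ... | false = count≡1⇒witness (CommonFat 𝔥 x y)
          (cross⇐ (pieceOf x fx) (pieceOf y fy) (otherPiece _ y fy sy) x y (pieceOf-mem x fx) (pieceOf-mem y fy) fx fy xy)

  -- An indecomposable fat Hoffman graph with one fat vertex, embedded in 𝔥, lies
  -- inside a single piece: otherwise its slim vertices inside and outside a piece
  -- would be pairwise adjacent (they share the image of the fat vertex), and
  -- `OneFat.split` would decompose it.
  oneFat-inPiece : (g : HG) → IsHoffman g → Indecomposable g → FatHG g → numFat g ≡ 1 →
    (e : Emb g 𝔥) → ∃ λ i → ∀ u → S i (ι e u) ≡ true
  oneFat-inPiece g Hg indec fatg one e = i₀ , inside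
    where
    open OneFat g Hg fatg one
    u₀ = proj₁ (IsHoffman.fatSl Hg φ φ-fat)
    fu₀ : fat g u₀ ≡ false
    fu₀ = proj₁ (proj₂ (IsHoffman.fatSl Hg φ φ-fat))
    slimImage : ∀ {u} → fat g u ≡ false → fat 𝔥 (ι e u) ≡ false
    slimImage {u} fu = trans (fatP e u) fu
    i₀ = pieceOf (ι e u₀) (slimImage fu₀)
    su₀ : S i₀ (ι e u₀) ≡ true
    su₀ = pieceOf-mem (ι e u₀) (slimImage fu₀)
    across : ∀ x y → fat g x ≡ false → fat g y ≡ false → S i₀ (ι e x) ≡ true → S i₀ (ι e y) ≡ false →
      adj g x y ≡ true
    across x y fx fy sx sy = trans (sym (adjP e x y))
      (SumFacts.differentPieces-adjacent sum i₀ _ (ι e x) (ι e y) (ι e φ) (otherPiece i₀ (ι e y) (slimImage fy) sy) sx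
        (pieceOf-mem (ι e y) (slimImage fy)) (slimImage fx) (slimImage fy)
        (commonFat-intro 𝔥 (trans (fatP e φ) φ-fat) (trans (adjP e x φ) (φ-adj x fx)) (trans (adjP e y φ) (φ-adj y fy))))
    inside : ∀ u → S i₀ (ι e u) ≡ true
    inside u with fat g u in fu
    ... | true = subst (λ z → S i₀ (ι e z) ≡ true) (sym (φ-unique u fu))
          (fatNbrs i₀ (ι e u₀) (ι e φ) su₀ (slimImage fu₀) (trans (fatP e φ) φ-fat) (trans (adjP e u₀ φ) (φ-adj u₀ fu₀)))
    ... | false with S i₀ (ι e u) in su
    ...   | true = refl
    ...   | false = ⊥-elim (split (λ w → S i₀ (ι e w)) across u₀ u fu₀ fu su₀ su indec)

module Closure (𝔥 : HG) (H𝔥 : IsHoffman 𝔥) (X : Fin (n 𝔥) → Bool) (Xslim : ∀ v → X v ≡ true → fat 𝔥 v ≡ false) where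

  C : Fin (n 𝔥) → Bool
  C = closure 𝔥 X

  N : HG
  N = ⟪_⟫ {𝔥} X

  ιN : Fin (n N) → Fin (n 𝔥)
  ιN = incl 𝔥 C

  X⊆C : ∀ v → X v ≡ true → C v ≡ true
  X⊆C v xv = ∨-intro₁ xv

  fatNbr∈C : ∀ x f → X x ≡ true → fat 𝔥 f ≡ true → adj 𝔥 x f ≡ true → C f ≡ true
  fatNbr∈C x f xx ff xf = ∨-intro₂ {X f} (∧-intro ff (any-allFin⁺ (λ z → X z ∧ adj 𝔥 z f) x (∧-intro xx xf)))

  C-slim : ∀ v → C v ≡ true → fat 𝔥 v ≡ false → X v ≡ true
  C-slim v cv fv with X v
  ... | true = refl
  ... | false = ⊥-elim (fat-slim (∧-true₁ cv) fv)

  C-fat : ∀ v → C v ≡ true → fat 𝔥 v ≡ true → ∃ λ x → X x ≡ true × adj 𝔥 x v ≡ true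
  C-fat v cv fv with X v in xv
  ... | true = ⊥-elim (fat-slim fv (Xslim v xv))
  ... | false = let (x , px) = any-allFin⁻ (λ z → X z ∧ adj 𝔥 z v) (∧-true₂ {fat 𝔥 v} cv) in
                x , ∧-true₁ px , ∧-true₂ {X x} px

  slimN-X : ∀ u → fat N u ≡ false → X (ιN u) ≡ true
  slimN-X u fu = C-slim (ιN u) (incl-mem 𝔥 C u) fu

  HN : IsHoffman N
  HN = subHoffman 𝔥 C H𝔥 (λ f cf ff → let (x , xx , xf) = C-fat f cf ff in x , X⊆C x xx , Xslim x xx , xf)

  fatNbrN : ∀ u → fat N u ≡ false → ∀ f → fat 𝔥 f ≡ true → adj 𝔥 (ιN u) f ≡ true →
    Σ (Fin (n N)) λ f′ → ιN f′ ≡ f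
  fatNbrN u fu f ff uf = let cf = fatNbr∈C (ιN u) f (slimN-X u fu) ff uf in pre 𝔥 C f cf , incl-pre 𝔥 C f cf

  commonFatN : ∀ u w f → fat N u ≡ false → CommonFat 𝔥 (ιN u) (ιN w) f ≡ true →
    Σ (Fin (n N)) λ f′ → CommonFat N u w f′ ≡ true
  commonFatN u w f fu cf =
    let (ff , uf , _) = commonFat-elim 𝔥 cf
        (f′ , e) = fatNbrN u fu f ff uf in
    f′ , subst (λ z → CommonFat 𝔥 (ιN u) (ιN w) z ≡ true) (sym e) cf

  X-in-C : ∀ u → C (incl 𝔥 X u) ≡ true
  X-in-C u = X⊆C _ (incl-mem 𝔥 X u)

  embX : Emb (sub 𝔥 X) N
  embX = corestrict 𝔥 C (inclEmb 𝔥 X) X-in-C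

  embX-onto-slim : ∀ y → fat N y ≡ false → ∃ λ x → ι embX x ≡ y
  embX-onto-slim y fy =
    let xy = slimN-X y fy ; x = pre 𝔥 X (ιN y) xy in
    x , incl-inj 𝔥 C _ y (trans (incl-corestrict 𝔥 C (inclEmb 𝔥 X) X-in-C x) (incl-pre 𝔥 X (ιN y) xy))

-- Given a decomposition 𝔫 = ⊕ T of a Hoffman graph whose
-- first p pieces are copies of h₁ and whose last q pieces lie in 𝒪, the graph
-- 𝔫~ = tilde 𝔫 p q T is again a sum, of the pieces
--   T(j) + f_j  (a copy of h₂)  for j < p,   and   T(p + j)  (unchanged)  for j < q.
-- Vertices of 𝔫~ are `x ↑ˡ p` (old vertices x) and `n 𝔫 ↑ʳ j` (new fat vertices f_j).

module Tilde (𝔫 : HG) (p q : ℕ) (T : Fin (p + q) → Fin (n 𝔫) → Bool) (TD : TildeDecomp 𝔫 p q T) where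

  private
    module Sum𝔫 = IsSum (proj₁ TD)
    h₁-pieces : ∀ j → Iso h₁ (sub 𝔫 (T (j ↑ˡ q)))
    h₁-pieces = proj₁ (proj₂ TD)

  𝔫~ : HG
  𝔫~ = tilde 𝔫 p q T

  old : Fin (n 𝔫) → Fin (n 𝔫~)
  old x = x ↑ˡ p

  new : Fin p → Fin (n 𝔫~)
  new j = n 𝔫 ↑ʳ j

  adj-old-old : ∀ x y → adj 𝔫~ (old x) (old y) ≡ adj 𝔫 x y
  adj-old-old x y rewrite splitAt-↑ˡ (n 𝔫) x p | splitAt-↑ˡ (n 𝔫) y p = refl

  adj-old-new : ∀ x j → adj 𝔫~ (old x) (new j) ≡ not (fat 𝔫 x) ∧ T (j ↑ˡ q) x
  adj-old-new x j rewrite splitAt-↑ˡ (n 𝔫) x p | splitAt-↑ʳ (n 𝔫) p j = refl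

  adj-new-old : ∀ j x → adj 𝔫~ (new j) (old x) ≡ not (fat 𝔫 x) ∧ T (j ↑ˡ q) x
  adj-new-old j x rewrite splitAt-↑ˡ (n 𝔫) x p | splitAt-↑ʳ (n 𝔫) p j = refl

  adj-new-new : ∀ j k → adj 𝔫~ (new j) (new k) ≡ false
  adj-new-new j k rewrite splitAt-↑ʳ (n 𝔫) p j | splitAt-↑ʳ (n 𝔫) p k = refl

  fat-old : ∀ x → fat 𝔫~ (old x) ≡ fat 𝔫 x
  fat-old x rewrite splitAt-↑ˡ (n 𝔫) x p = refl

  fat-new : ∀ j → fat 𝔫~ (new j) ≡ true
  fat-new j rewrite splitAt-↑ʳ (n 𝔫) p j = refl

  data Vertex (u : Fin (n 𝔫~)) : Set where
    isOld : ∀ x → u ≡ old x → Vertex u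
    isNew : ∀ j → u ≡ new j → Vertex u

  vertex : ∀ u → Vertex u
  vertex u with splitAt (n 𝔫) u in eq
  ... | inj₁ x = isOld x (sym (splitAt⁻¹-↑ˡ eq))
  ... | inj₂ j = isNew j (sym (splitAt⁻¹-↑ʳ eq))

  slimOld : ∀ u → fat 𝔫~ u ≡ false → Σ (Fin (n 𝔫)) λ x → u ≡ old x × fat 𝔫 x ≡ false
  slimOld u fu with vertex u
  ... | isOld x refl = x , refl , trans (sym (fat-old x)) fu
  ... | isNew j refl = ⊥-elim (fat-slim (fat-new j) fu)

  embOld : Emb 𝔫 𝔫~
  embOld = record { ι = old ; inj = λ u v e → ↑ˡ-injective p u v e ; adjP = adj-old-old ; fatP = fat-old }

  slim-h₁ : ∀ j → Σ (Fin (n 𝔫)) λ s → fat 𝔫 s ≡ false × T (j ↑ˡ q) s ≡ true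
  slim-h₁ j = let (s , _ , fs , _) = h₁-shape (sub 𝔫 (T (j ↑ˡ q))) (h₁-pieces j) in
    incl 𝔫 (T (j ↑ˡ q)) s , fs , incl-mem 𝔫 (T (j ↑ˡ q)) s

  new-nonadj-fat : ∀ {i} x → fat 𝔫 x ≡ true → not (fat 𝔫 x) ∧ T i x ≡ false
  new-nonadj-fat x fx rewrite fx = refl

  tildeHoffman : IsHoffman 𝔫~
  tildeHoffman = record { sym = symmetric ; irr = irreflexive ; fatNA = fatNonadj ; fatSl = fatSlimNbr }
    where
    H = Sum𝔫.hoff
    symmetric : ∀ u v → adj 𝔫~ u v ≡ adj 𝔫~ v u
    symmetric u v with vertex u | vertex v
    ... | isOld x refl | isOld y refl = trans (adj-old-old x y) (trans (IsHoffman.sym H x y) (sym (adj-old-old y x)))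
    ... | isOld x refl | isNew j refl = trans (adj-old-new x j) (sym (adj-new-old j x))
    ... | isNew j refl | isOld x refl = trans (adj-new-old j x) (sym (adj-old-new x j))
    ... | isNew j refl | isNew k refl = trans (adj-new-new j k) (sym (adj-new-new k j))
    irreflexive : ∀ u → adj 𝔫~ u u ≡ false
    irreflexive u with vertex u
    ... | isOld x refl = trans (adj-old-old x x) (IsHoffman.irr H x)
    ... | isNew j refl = adj-new-new j j
    fatNonadj : ∀ u v → fat 𝔫~ u ≡ true → fat 𝔫~ v ≡ true → adj 𝔫~ u v ≡ false
    fatNonadj u v fu fv with vertex u | vertex v
    ... | isOld x refl | isOld y refl =
          trans (adj-old-old x y) (IsHoffman.fatNA H x y (trans (sym (fat-old x)) fu) (trans (sym (fat-old y)) fv))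
    ... | isOld x refl | isNew j refl = trans (adj-old-new x j) (new-nonadj-fat {j ↑ˡ q} x (trans (sym (fat-old x)) fu))
    ... | isNew j refl | isOld x refl = trans (adj-new-old j x) (new-nonadj-fat {j ↑ˡ q} x (trans (sym (fat-old x)) fv))
    ... | isNew j refl | isNew k refl = adj-new-new j k
    fatSlimNbr : ∀ f → fat 𝔫~ f ≡ true → ∃ λ x → fat 𝔫~ x ≡ false × adj 𝔫~ x f ≡ true
    fatSlimNbr f ff with vertex f
    ... | isOld y refl = let (x , fx , xy) = IsHoffman.fatSl H y (trans (sym (fat-old y)) ff) in
          old x , trans (fat-old x) fx , trans (adj-old-old x y) xy
    ... | isNew j refl = let (s , fs , ts) = slim-h₁ j in
          old s , trans (fat-old s) fs , trans (adj-old-new s j) (∧-intro (not-false fs) ts)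

  piece : Fin (p + q) → Fin (n 𝔫~) → Bool
  piece i u = [ T i , (λ j → eqF i (j ↑ˡ q)) ]′ (splitAt (n 𝔫) u)

  piece-old : ∀ i x → piece i (old x) ≡ T i x
  piece-old i x rewrite splitAt-↑ˡ (n 𝔫) x p = refl

  piece-new : ∀ i j → piece i (new j) ≡ eqF i (j ↑ˡ q)
  piece-new i j rewrite splitAt-↑ʳ (n 𝔫) p j = refl

  piece-old⁻ : ∀ {i x} → piece i (old x) ≡ true → T i x ≡ true
  piece-old⁻ {i} {x} e = trans (sym (piece-old i x)) e

  common-new : ∀ x y k → CommonFat 𝔫~ (old x) (old y) (new k) ≡ true → T (k ↑ˡ q) x ≡ true × T (k ↑ˡ q) y ≡ true
  common-new x y k e rewrite fat-new k | adj-old-new x k | adj-old-new y k =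
    ∧-true₂ {not (fat 𝔫 x)} (∧-true₁ e) , ∧-true₂ {not (fat 𝔫 y)} (∧-true₂ {not (fat 𝔫 x) ∧ T (k ↑ˡ q) x} e)

  common-old : ∀ x y f → CommonFat 𝔫~ (old x) (old y) (old f) ≡ CommonFat 𝔫 x y f
  common-old x y f rewrite fat-old f | adj-old-old x f | adj-old-old y f = refl

  common-crossing : ∀ i j x y → ¬ i ≡ j → T i x ≡ true → T j y ≡ true → fat 𝔫 x ≡ false → fat 𝔫 y ≡ false →
    ∀ f → CommonFat 𝔫~ (old x) (old y) f ≡ true → Σ (Fin (n 𝔫)) λ f′ → f ≡ old f′ × CommonFat 𝔫 x y f′ ≡ true
  common-crossing i j x y i≢j tx ty fx fy f cf with vertex f
  ... | isOld f′ refl = f′ , refl , trans (sym (common-old x y f′)) cf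
  ... | isNew k refl = let (kx , ky) = common-new x y k cf in
        ⊥-elim (i≢j (trans (Sum𝔫.slimUniq x fx i (k ↑ˡ q) tx kx) (Sum𝔫.slimUniq y fy (k ↑ˡ q) j ky ty)))

  crossing-atMost1 : ∀ i j x y → ¬ i ≡ j → T i x ≡ true → T j y ≡ true → fat 𝔫 x ≡ false → fat 𝔫 y ≡ false →
    AtMost1 (CommonFat 𝔫~ (old x) (old y))
  crossing-atMost1 i j x y i≢j tx ty fx fy a b ca cb =
    let (a′ , ea , ca′) = common-crossing i j x y i≢j tx ty fx fy a ca
        (b′ , eb , cb′) = common-crossing i j x y i≢j tx ty fx fy b cb
        atMost1 = count≤1⇒atMost1 (CommonFat 𝔫 x y) (Sum𝔫.cross≤1 i j i≢j x y tx ty fx fy) in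
    trans ea (trans (cong old (atMost1 a′ b′ ca′ cb′)) (sym eb))

  tildeSum : IsSum 𝔫~ (p + q) piece
  tildeSum = record
    { hoff = tildeHoffman
    ; pieces = λ i → subHoffman 𝔫~ (piece i) tildeHoffman (slimNbr i)
    ; cover = covered
    ; slimIn = λ u fu → let (x , ux , fx) = slimOld u fu ; (i , t) = Sum𝔫.slimIn x fx in
                        i , subst (λ z → piece i z ≡ true) (sym ux) (trans (piece-old i x) t)
    ; slimUniq = slimUnique
    ; fatNbrs = fatNbrsIn
    ; cross≤1 = λ i j i≢j u w su sw fu fw → crossing i j u w su sw fu fw λ x y tx ty fx fy →
                  atMost1⇒count≤1 (CommonFat 𝔫~ (old x) (old y)) (crossing-atMost1 i j x y i≢j tx ty fx fy)
    ; cross≡1⇒ = λ i j i≢j u w su sw fu fw → crossing i j u w su sw fu fw (cross-one⇒adj i j i≢j)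
    ; cross⇐ = λ i j i≢j u w su sw fu fw → crossing i j u w su sw fu fw (cross-adj⇒one i j i≢j)
    }
    where
    crossing : ∀ {A : Fin (n 𝔫~) → Fin (n 𝔫~) → Set} i j → ∀ u w → piece i u ≡ true → piece j w ≡ true →
      fat 𝔫~ u ≡ false → fat 𝔫~ w ≡ false →
      (∀ x y → T i x ≡ true → T j y ≡ true → fat 𝔫 x ≡ false → fat 𝔫 y ≡ false → A (old x) (old y)) → A u w
    crossing i j u w su sw fu fw k with slimOld u fu | slimOld w fw
    ... | x , refl , fx | y , refl , fy = k x y (piece-old⁻ su) (piece-old⁻ sw) fx fy

    slimNbr : ∀ i f → piece i f ≡ true → fat 𝔫~ f ≡ true →
      ∃ λ x → piece i x ≡ true × fat 𝔫~ x ≡ false × adj 𝔫~ x f ≡ true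
    slimNbr i f sf ff with vertex f
    ... | isOld y refl =
          let (x , tx , fx , xy) = subSlimNbr 𝔫 (T i) (Sum𝔫.pieces i) y (piece-old⁻ sf) (trans (sym (fat-old y)) ff) in
          old x , trans (piece-old i x) tx , trans (fat-old x) fx , trans (adj-old-old x y) xy
    ... | isNew j refl with eqF-sound {x = i} {y = j ↑ˡ q} (trans (sym (piece-new i j)) sf)
    ...   | refl = let (s , fs , ts) = slim-h₁ j in
            old s , trans (piece-old i s) ts , trans (fat-old s) fs , trans (adj-old-new s j) (∧-intro (not-false fs) ts)

    covered : ∀ u → ∃ λ i → piece i u ≡ true
    covered u with vertex u
    ... | isOld x refl = let (i , t) = Sum𝔫.cover x in i , trans (piece-old i x) t
    ... | isNew j refl = j ↑ˡ q , trans (piece-new (j ↑ˡ q) j) (eqF-refl (j ↑ˡ q))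

    slimUnique : ∀ u → fat 𝔫~ u ≡ false → ∀ i j → piece i u ≡ true → piece j u ≡ true → i ≡ j
    slimUnique u fu i j si sj with slimOld u fu
    ... | x , refl , fx = Sum𝔫.slimUniq x fx i j (piece-old⁻ si) (piece-old⁻ sj)

    fatNbrsIn : ∀ i u f → piece i u ≡ true → fat 𝔫~ u ≡ false → fat 𝔫~ f ≡ true → adj 𝔫~ u f ≡ true →
      piece i f ≡ true
    fatNbrsIn i u f su fu ff uf with slimOld u fu
    ... | x , refl , fx with vertex f
    ...   | isOld y refl = trans (piece-old i y)
            (Sum𝔫.fatNbrs i x y (piece-old⁻ su) fx (trans (sym (fat-old y)) ff) (trans (sym (adj-old-old x y)) uf))
    ...   | isNew k refl with Sum𝔫.slimUniq x fx i (k ↑ˡ q) (piece-old⁻ su)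
                                (∧-true₂ {not (fat 𝔫 x)} (trans (sym (adj-old-new x k)) uf))
    ...     | refl = trans (piece-new (k ↑ˡ q) k) (eqF-refl (k ↑ˡ q))

    cross-one⇒adj : ∀ i j → ¬ i ≡ j → ∀ x y → T i x ≡ true → T j y ≡ true → fat 𝔫 x ≡ false → fat 𝔫 y ≡ false →
      commonFat 𝔫~ (old x) (old y) ≡ 1 → adj 𝔫~ (old x) (old y) ≡ true
    cross-one⇒adj i j i≢j x y tx ty fx fy one =
      let (f , cf) = count≡1⇒witness (CommonFat 𝔫~ (old x) (old y)) one
          (f′ , _ , cf′) = common-crossing i j x y i≢j tx ty fx fy f cf
          atMost1 = count≤1⇒atMost1 (CommonFat 𝔫 x y) (Sum𝔫.cross≤1 i j i≢j x y tx ty fx fy) in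
      trans (adj-old-old x y) (Sum𝔫.cross≡1⇒ i j i≢j x y tx ty fx fy (count≡1 (CommonFat 𝔫 x y) f′ cf′ atMost1))

    cross-adj⇒one : ∀ i j → ¬ i ≡ j → ∀ x y → T i x ≡ true → T j y ≡ true → fat 𝔫 x ≡ false → fat 𝔫 y ≡ false →
      adj 𝔫~ (old x) (old y) ≡ true → commonFat 𝔫~ (old x) (old y) ≡ 1
    cross-adj⇒one i j i≢j x y tx ty fx fy xy =
      let (f , cf) = count≡1⇒witness (CommonFat 𝔫 x y)
                       (Sum𝔫.cross⇐ i j i≢j x y tx ty fx fy (trans (sym (adj-old-old x y)) xy)) in
      count≡1 (CommonFat 𝔫~ (old x) (old y)) (old f) (trans (common-old x y f) cf)
        (crossing-atMost1 i j x y i≢j tx ty fx fy)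

  -- the piece of f_j is a copy of h₂: s_j adjacent to the fat vertex of T(j) and to f_j
  newPiece-h₂ : ∀ j → Iso h₂ (sub 𝔫~ (piece (j ↑ˡ q)))
  newPiece-h₂ j with h₁-shape (sub 𝔫 (T (j ↑ˡ q))) (h₁-pieces j)
  ... | s₁ , f₁ , fs , ff , sf , onlySF = h₂-iso (sub 𝔫~ P) (IsSum.pieces tildeSum i) (⟨ old s ⟩ ps) (⟨ old f ⟩ pf) (⟨ new j ⟩ pj)
    (trans (cong (fat 𝔫~) (back ps)) (trans (fat-old s) fs)) (trans (cong (fat 𝔫~) (back pf)) (trans (fat-old f) ff))
    (trans (cong (fat 𝔫~) (back pj)) (fat-new j))
    (λ e → ↑ˡ≢↑ʳ f j (trans (sym (back pf)) (trans (cong (incl 𝔫~ P) e) (back pj))))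
    (trans (cong₂ (adj 𝔫~) (back ps) (back pf)) (trans (adj-old-old s f) sf))
    (trans (cong₂ (adj 𝔫~) (back ps) (back pj)) (trans (adj-old-new s j) (∧-intro (not-false fs) ts)))
    onlyThree
    where
    i = j ↑ˡ q
    P = piece i
    ⟨_⟩_ : ∀ v → P v ≡ true → Fin (n (sub 𝔫~ P))
    ⟨ v ⟩ pv = pre 𝔫~ P v pv
    back : ∀ {v} (pv : P v ≡ true) → incl 𝔫~ P (⟨ v ⟩ pv) ≡ v
    back {v} pv = incl-pre 𝔫~ P v pv
    s = incl 𝔫 (T i) s₁
    f = incl 𝔫 (T i) f₁
    ts : T i s ≡ true
    ts = incl-mem 𝔫 (T i) s₁
    ps : P (old s) ≡ true
    ps = trans (piece-old i s) ts
    pf : P (old f) ≡ true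
    pf = trans (piece-old i f) (incl-mem 𝔫 (T i) f₁)
    pj : P (new j) ≡ true
    pj = trans (piece-new i j) (eqF-refl i)
    onlyThree : ∀ v → v ≡ ⟨ old s ⟩ ps ⊎ v ≡ ⟨ old f ⟩ pf ⊎ v ≡ ⟨ new j ⟩ pj
    onlyThree v with vertex (incl 𝔫~ P v) | incl-mem 𝔫~ P v
    ... | isOld x e | pv with onlySF (pre 𝔫 (T i) x (piece-old⁻ (subst (λ z → P z ≡ true) e pv)))
    ...   | inj₁ e₁ = inj₁ (pre-unique 𝔫~ P v (old s) ps (trans e (cong old
              (trans (sym (incl-pre 𝔫 (T i) x _)) (cong (incl 𝔫 (T i)) e₁)))))
    ...   | inj₂ e₁ = inj₂ (inj₁ (pre-unique 𝔫~ P v (old f) pf (trans e (cong old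
              (trans (sym (incl-pre 𝔫 (T i) x _)) (cong (incl 𝔫 (T i)) e₁))))))
    onlyThree v | isNew k e | pv = inj₂ (inj₂ (pre-unique 𝔫~ P v (new j) pj (trans e (cong new
              (sym (↑ˡ-injective q j k (eqF-sound (trans (sym (piece-new i k)) (subst (λ z → P z ≡ true) e pv)))))))))

  oldPiece-iso : ∀ j → Iso (sub 𝔫 (T (p ↑ʳ j))) (sub 𝔫~ (piece (p ↑ʳ j)))
  oldPiece-iso j = e , onto
    where
    i = p ↑ʳ j
    inPiece : ∀ u → piece i (ι (embOld ∘E inclEmb 𝔫 (T i)) u) ≡ true
    inPiece u = trans (piece-old i _) (incl-mem 𝔫 (T i) u)
    e : Emb (sub 𝔫 (T i)) (sub 𝔫~ (piece i))
    e = corestrict 𝔫~ (piece i) (embOld ∘E inclEmb 𝔫 (T i)) inPiece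
    onto : ∀ v → ∃ λ u → ι e u ≡ v
    onto v with vertex (incl 𝔫~ (piece i) v) | incl-mem 𝔫~ (piece i) v
    ... | isOld x eq | pv =
          let tx = piece-old⁻ (subst (λ z → piece i z ≡ true) eq pv) ; u = pre 𝔫 (T i) x tx in
          u , incl-inj 𝔫~ (piece i) _ v (trans (incl-corestrict 𝔫~ (piece i) (embOld ∘E inclEmb 𝔫 (T i)) inPiece u)
                (trans (cong old (incl-pre 𝔫 (T i) x tx)) (sym eq)))
    ... | isNew k eq | pv = ↑ˡ≢↑ʳ k j (sym (eqF-sound (trans (sym (piece-new i k)) (subst (λ z → piece i z ≡ true) eq pv))))

bar-iso : ∀ {F g g′} → bar F g → Iso g g′ → bar F g′
bar-iso (inj₁ isoH₂) iso = inj₁ (isoTrans iso isoH₂)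
bar-iso (inj₂ ((g₀ , o , iso₀) , g″ , fg″ , e)) iso = inj₂ ((g₀ , o , isoTrans iso iso₀) , g″ , fg″ , e ∘E proj₁ (isoSym iso))

FSum-in𝒪 : ∀ ℋ → ℋ ⊆𝒪 → ∀ {𝔥 m S} → IsFSum ℋ 𝔥 m S → ∀ i → sub 𝔥 (S i) ∈ᶠ 𝒪
FSum-in𝒪 ℋ H𝒪 FS i =
  let (g′ , hg′ , iso′) = proj₂ FS i ; (g″ , og″ , iso″) = H𝒪 g′ hg′ in g″ , og″ , isoTrans iso′ iso″

-- A member of 𝒪 embedded in a sum of members of ℋ ⊆ 𝒪 belongs to ℋ̄: either it is
-- h₂, or it has one fat vertex and, by `oneFat-inPiece`, lies inside one piece.
𝒪-in-bar : ∀ ℋ → ℋ ⊆𝒪 → ∀ {𝔥 m S} → IsFSum ℋ 𝔥 m S → ∀ g → 𝒪 g → Emb g 𝔥 → bar ℋ g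
𝒪-in-bar ℋ H𝒪 FS g (inj₁ isoH₂) e = inj₁ isoH₂
𝒪-in-bar ℋ H𝒪 {𝔥} {m} {S} FS g o@(inj₂ (Hg , indec , fatg , _ , one)) e =
  let (i , inside) = SumOf𝒪.oneFat-inPiece 𝔥 m S (proj₁ FS) (FSum-in𝒪 ℋ H𝒪 FS) g Hg indec fatg one e
      (g′ , hg′ , iso) = proj₂ FS i in
  inj₂ ((g , o , isoRefl g) , g′ , hg′ , proj₁ (isoSym iso) ∘E corestrict 𝔥 (S i) e inside)

tilde-strictCover : ∀ ℋ → ℋ ⊆𝒪 → ∀ 𝔥 m S → IsFSum ℋ 𝔥 m S →
  ∀ X → (∀ v → X v ≡ true → fat 𝔥 v ≡ false) → ∀ p q T → TildeDecomp (⟪_⟫ {𝔥} X) p q T →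
  StrictCover (bar ℋ) (sub 𝔥 X) (tilde (⟪_⟫ {𝔥} X) p q T)
tilde-strictCover ℋ H𝒪 𝔥 m S FS X Xslim p q T TD =
  (p + q , piece , tildeSum , λ i → sub 𝔫~ (piece i) , barPiece i , isoRefl _) , embOld ∘E embX , onto
  where
  open Closure 𝔥 (IsSum.hoff (proj₁ FS)) X Xslim
  open Tilde N p q T TD

  oldPiece-bar : ∀ j → bar ℋ (sub 𝔫~ (piece (p ↑ʳ j)))
  oldPiece-bar j =
    let (g₀ , o₀ , iso₀) = proj₂ (proj₂ TD) j
        inN = inclEmb N (T (p ↑ʳ j)) ∘E proj₁ iso₀ in
    bar-iso (𝒪-in-bar ℋ H𝒪 FS g₀ o₀ (inclEmb 𝔥 C ∘E inN)) (isoTrans (oldPiece-iso j) iso₀)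

  barPiece : ∀ i → bar ℋ (sub 𝔫~ (piece i))
  barPiece i with splitAt p i in eq
  ... | inj₁ j = subst (λ z → bar ℋ (sub 𝔫~ (piece z))) (splitAt⁻¹-↑ˡ eq) (inj₁ (newPiece-h₂ j))
  ... | inj₂ j = subst (λ z → bar ℋ (sub 𝔫~ (piece z))) (splitAt⁻¹-↑ʳ eq) (oldPiece-bar j)

  onto : ∀ y → fat 𝔫~ y ≡ false → ∃ λ x → ι (embOld ∘E embX) x ≡ y
  onto y fy with slimOld y fy
  ... | x , refl , fx = let (u , eu) = embX-onto-slim x fx in u , cong old eu

module Enumerate {k : ℕ} (A B : Fin k → Bool) (disjoint : ∀ ℓ → A ℓ ≡ true → B ℓ ≡ true → ⊥) where

  p q : ℕ
  p = count A
  q = count B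

  label : Fin (p + q) → Fin k
  label i = [ lookup (select A) , lookup (select B) ]′ (splitAt p i)

  label-first : ∀ j → label (j ↑ˡ q) ≡ lookup (select A) j
  label-first j = cong [ lookup (select A) , lookup (select B) ]′ (splitAt-↑ˡ p j q)

  label-last : ∀ j → label (p ↑ʳ j) ≡ lookup (select B) j
  label-last j = cong [ lookup (select A) , lookup (select B) ]′ (splitAt-↑ʳ p q j)

  label-A : ∀ j → A (label (j ↑ˡ q)) ≡ true
  label-A j = subst (λ ℓ → A ℓ ≡ true) (sym (label-first j)) (All.lookup (select-sound A) (∈-lookup j))

  label-B : ∀ j → B (label (p ↑ʳ j)) ≡ true
  label-B j = subst (λ ℓ → B ℓ ≡ true) (sym (label-last j)) (All.lookup (select-sound B) (∈-lookup j))

  label-onto : ∀ ℓ → A ℓ ≡ true ⊎ B ℓ ≡ true → ∃ λ i → label i ≡ ℓ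
  label-onto ℓ (inj₁ aℓ) = let m = select-complete A ℓ aℓ in
    Any.index m ↑ˡ q , trans (label-first (Any.index m)) (sym (lookup-index m))
  label-onto ℓ (inj₂ bℓ) = let m = select-complete B ℓ bℓ in
    p ↑ʳ Any.index m , trans (label-last (Any.index m)) (sym (lookup-index m))

  label-inj : ∀ i j → label i ≡ label j → i ≡ j
  label-inj i j e = go (splitAt p i) (splitAt p j) refl refl
    where
    go : ∀ si sj → splitAt p i ≡ si → splitAt p j ≡ sj → i ≡ j
    go (inj₁ a) (inj₁ b) ei ej = trans (sym (splitAt⁻¹-↑ˡ ei))
      (trans (cong (_↑ˡ q) (lookup-injective (select-unique A) a b (trans (sym (label-first a))
        (trans (cong label (splitAt⁻¹-↑ˡ ei)) (trans e (trans (cong label (sym (splitAt⁻¹-↑ˡ ej))) (label-first b)))))))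
      (splitAt⁻¹-↑ˡ ej))
    go (inj₂ a) (inj₂ b) ei ej = trans (sym (splitAt⁻¹-↑ʳ ei))
      (trans (cong (p ↑ʳ_) (lookup-injective (select-unique B) a b (trans (sym (label-last a))
        (trans (cong label (splitAt⁻¹-↑ʳ ei)) (trans e (trans (cong label (sym (splitAt⁻¹-↑ʳ ej))) (label-last b)))))))
      (splitAt⁻¹-↑ʳ ej))
    go (inj₁ a) (inj₂ b) ei ej = ⊥-elim (disjoint (label j)
      (subst (λ ℓ → A ℓ ≡ true) (trans (cong label (splitAt⁻¹-↑ˡ ei)) e) (label-A a))
      (subst (λ ℓ → B ℓ ≡ true) (cong label (splitAt⁻¹-↑ʳ ej)) (label-B b)))
    go (inj₂ a) (inj₁ b) ei ej = ⊥-elim (disjoint (label i)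
      (subst (λ ℓ → A ℓ ≡ true) (trans (cong label (splitAt⁻¹-↑ˡ ej)) (sym e)) (label-A b))
      (subst (λ ℓ → B ℓ ≡ true) (cong label (splitAt⁻¹-↑ʳ ei)) (label-B a)))

module Decomposition (𝔥 : HG) (m : ℕ) (S : Fin m → Fin (n 𝔥) → Bool) (sum : IsSum 𝔥 m S)
                     (in𝒪 : ∀ i → sub 𝔥 (S i) ∈ᶠ 𝒪)
                     (X : Fin (n 𝔥) → Bool) (Xslim : ∀ v → X v ≡ true → fat 𝔥 v ≡ false) where

  open SumOf𝒪 𝔥 m S sum in𝒪
  open Closure 𝔥 (IsSum.hoff sum) X Xslim
  open IsSum sum using (fatNbrs)

  V : Set
  V = Fin (n N)

  commonFatN-atMost1 : ∀ u w → fat N u ≡ false → fat N w ≡ false → ¬ u ≡ w → AtMost1 (CommonFat N u w)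
  commonFatN-atMost1 u w fu fw u≢w a b ca cb =
    incl-inj 𝔥 C a b (commonFat-atMost1 (ιN u) (ιN w) fu fw (λ e → u≢w (incl-inj 𝔥 C u w e)) (ιN a) (ιN b) ca cb)

  Linked : V → V → Bool
  Linked u w = not (fat N u) ∧ (not (fat N w) ∧ (not (adj N u w) ∧ any (CommonFat N u w) (allFin (n N))))

  linked-elim : ∀ u w → Linked u w ≡ true →
    fat N u ≡ false × fat N w ≡ false × adj N u w ≡ false × ∃ λ f → CommonFat N u w f ≡ true
  linked-elim u w e =
    let e₁ = ∧-true₂ {not (fat N u)} e ; e₂ = ∧-true₂ {not (fat N w)} e₁ ; e₃ = ∧-true₂ {not (adj N u w)} e₂ in
    not-true (∧-true₁ e) , not-true (∧-true₁ e₁) , not-true (∧-true₁ e₂) , any-allFin⁻ (CommonFat N u w) e₃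

  linked-intro : ∀ u w f → fat N u ≡ false → fat N w ≡ false → adj N u w ≡ false → CommonFat N u w f ≡ true →
    Linked u w ≡ true
  linked-intro u w f fu fw uw cf =
    ∧-intro (not-false fu) (∧-intro (not-false fw) (∧-intro (not-false uw) (any-allFin⁺ (CommonFat N u w) f cf)))

  linked-sym : ∀ u w → Linked u w ≡ true → Linked w u ≡ true
  linked-sym u w e = let (fu , fw , uw , f , cf) = linked-elim u w e in
    linked-intro w u f fw fu (trans (IsHoffman.sym HN w u) uw) (commonFat-sym N cf)

  open Components Linked linked-sym

  InClass : V → V → Bool
  InClass ℓ u = not (fat N u) ∧ eqF (component u) ℓ

  FatOf : V → V → Bool
  FatOf ℓ v = fat N v ∧ any (λ x → InClass ℓ x ∧ adj N x v) (allFin (n N))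

  InPiece : V → V → Bool
  InPiece ℓ v = InClass ℓ v ∨ FatOf ℓ v

  inClass-elim : ∀ {ℓ u} → InClass ℓ u ≡ true → fat N u ≡ false × component u ≡ ℓ
  inClass-elim {ℓ} {u} e = not-true (∧-true₁ e) , eqF-sound (∧-true₂ {not (fat N u)} e)

  inClass-own : ∀ u → fat N u ≡ false → InClass (component u) u ≡ true
  inClass-own u fu = ∧-intro (not-false fu) (eqF-refl (component u))

  fatOf-intro : ∀ ℓ x f → InClass ℓ x ≡ true → fat N f ≡ true → adj N x f ≡ true → FatOf ℓ f ≡ true
  fatOf-intro ℓ x f cx ff xf = ∧-intro ff (any-allFin⁺ (λ z → InClass ℓ z ∧ adj N z f) x (∧-intro cx xf))

  fatOf-elim : ∀ ℓ f → FatOf ℓ f ≡ true → fat N f ≡ true × ∃ λ x → InClass ℓ x ≡ true × adj N x f ≡ true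
  fatOf-elim ℓ f e = let (x , px) = any-allFin⁻ (λ z → InClass ℓ z ∧ adj N z f) (∧-true₂ {fat N f} e) in
    ∧-true₁ e , x , ∧-true₁ px , ∧-true₂ {InClass ℓ x} px

  inPiece-slim : ∀ ℓ v → InPiece ℓ v ≡ true → fat N v ≡ false → InClass ℓ v ≡ true
  inPiece-slim ℓ v e fv with ∨-elim {InClass ℓ v} e
  ... | inj₁ cv = cv
  ... | inj₂ fatv = ⊥-elim (fat-slim (∧-true₁ fatv) fv)

  inPiece-fat : ∀ ℓ v → InPiece ℓ v ≡ true → fat N v ≡ true → FatOf ℓ v ≡ true
  inPiece-fat ℓ v e fv with ∨-elim {InClass ℓ v} e
  ... | inj₁ cv = ⊥-elim (fat-slim fv (proj₁ (inClass-elim cv)))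
  ... | inj₂ fatv = fatv

  class-path : ∀ {ℓ u w} → InClass ℓ u ≡ true → InClass ℓ w ≡ true → Path u w
  class-path cu cw = component-path _ _ (trans (proj₂ (inClass-elim cu)) (sym (proj₂ (inClass-elim cw))))

  pieceHoffman : ∀ ℓ → IsHoffman (sub N (InPiece ℓ))
  pieceHoffman ℓ = subHoffman N (InPiece ℓ) HN (λ f pf ff →
    let (_ , x , cx , xf) = fatOf-elim ℓ f (inPiece-fat ℓ f pf ff) in
    x , ∨-intro₁ cx , proj₁ (inClass-elim cx) , xf)

  Used : V → Bool
  Used ℓ = any (InClass ℓ) (allFin (n N))

  IsH₁Class : V → Bool
  IsH₁Class ℓ = Used ℓ ∧ ((count (InClass ℓ) ≡ᵇ 1) ∧ (count (FatOf ℓ) ≡ᵇ 1))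

  Is𝒪Class : V → Bool
  Is𝒪Class ℓ = Used ℓ ∧ not (IsH₁Class ℓ)

  open Enumerate IsH₁Class Is𝒪Class (λ ℓ h o → true≢false (trans (sym h) (not-true (∧-true₂ {Used ℓ} o)))) public

  part : Fin (p + q) → V → Bool
  part i = InPiece (label i)

  label-of-used : ∀ ℓ → Used ℓ ≡ true → ∃ λ i → label i ≡ ℓ
  label-of-used ℓ used = go (IsH₁Class ℓ) refl
    where
    go : ∀ b → IsH₁Class ℓ ≡ b → ∃ λ i → label i ≡ ℓ
    go true h = label-onto ℓ (inj₁ h)
    go false h = label-onto ℓ (inj₂ (∧-intro used (not-false h)))

  inSomePiece : ∀ ℓ v → InPiece ℓ v ≡ true → Used ℓ ≡ true → ∃ λ i → part i v ≡ true
  inSomePiece ℓ v pv used = let (i , e) = label-of-used ℓ used in i , subst (λ z → InPiece z v ≡ true) (sym e) pv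

  slimCovered : ∀ v → fat N v ≡ false → ∃ λ i → part i v ≡ true
  slimCovered v fv = inSomePiece (component v) v (∨-intro₁ cv) (any-allFin⁺ (InClass (component v)) v cv)
    where cv = inClass-own v fv

  fatCovered : ∀ v → fat N v ≡ true → ∃ λ i → part i v ≡ true
  fatCovered v fv =
    let (x , xx , xv) = C-fat (ιN v) (incl-mem 𝔥 C v) fv
        x′ = pre 𝔥 C x (X⊆C x xx)
        ex = incl-pre 𝔥 C x (X⊆C x xx)
        cx′ = inClass-own x′ (trans (cong (fat 𝔥) ex) (Xslim x xx))
        ℓ = component x′ in
    inSomePiece ℓ v (∨-intro₂ {InClass ℓ v} (fatOf-intro ℓ x′ v cx′ fv (trans (cong (λ z → adj 𝔥 z (ιN v)) ex) xv)))
      (any-allFin⁺ (InClass ℓ) x′ cx′)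

  component-label : ∀ i x → part i x ≡ true → fat N x ≡ false → component x ≡ label i
  component-label i x tx fx = proj₂ (inClass-elim (inPiece-slim (label i) x tx fx))

  slimUnique : ∀ x → fat N x ≡ false → ∀ i j → part i x ≡ true → part j x ≡ true → i ≡ j
  slimUnique x fx i j ti tj = label-inj i j (trans (sym (component-label i x ti fx)) (component-label j x tj fx))

  decomposition : IsSum N (p + q) part
  decomposition = record
    { hoff = HN
    ; pieces = λ i → pieceHoffman (label i)
    ; cover = λ v → covered v (fat N v) refl
    ; slimIn = slimCovered
    ; slimUniq = slimUnique
    ; fatNbrs = λ i x f tx fx ff xf → ∨-intro₂ {InClass (label i) f}
                  (fatOf-intro (label i) x f (inPiece-slim (label i) x tx fx) ff xf)
    ; cross≤1 = λ i j i≢j x y tx ty fx fy →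
                  atMost1⇒count≤1 (CommonFat N x y) (commonFatN-atMost1 x y fx fy (distinct i j i≢j x y tx ty fx))
    ; cross≡1⇒ = cross-one⇒adj
    ; cross⇐ = λ i j i≢j x y tx ty fx fy xy →
        let (f , cf) = adjacent-commonFat (ιN x) (ιN y) fx fy xy
            (f′ , cf′) = commonFatN x y f fx cf in
        count≡1 (CommonFat N x y) f′ cf′ (commonFatN-atMost1 x y fx fy (distinct i j i≢j x y tx ty fx))
    }
    where
    covered : ∀ v b → fat N v ≡ b → ∃ λ i → part i v ≡ true
    covered v true fv = fatCovered v fv
    covered v false fv = slimCovered v fv
    distinct : ∀ i j → ¬ i ≡ j → ∀ x y → part i x ≡ true → part j y ≡ true → fat N x ≡ false → ¬ x ≡ y
    distinct i j i≢j x y tx ty fx refl = i≢j (slimUnique x fx i j tx ty)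
    -- a common fat neighbour of non-adjacent x, y would link them into one class
    cross-one⇒adj : ∀ i j → ¬ i ≡ j → ∀ x y → part i x ≡ true → part j y ≡ true → fat N x ≡ false → fat N y ≡ false →
      commonFat N x y ≡ 1 → adj N x y ≡ true
    cross-one⇒adj i j i≢j x y tx ty fx fy one = byCases (adj N x y) refl
      where
      byCases : ∀ b → adj N x y ≡ b → adj N x y ≡ true
      byCases true xy = xy
      byCases false xy = let (f , cf) = count≡1⇒witness (CommonFat N x y) one in
        ⊥-elim (i≢j (label-inj i j (trans (sym (component-label i x tx fx))
          (trans (edge-component x y (linked-intro x y f fx fy xy cf)) (component-label j y ty fy)))))

  path-inPiece : ∀ i {u w} → Path u w → S i (ιN u) ≡ true → fat N u ≡ false → S i (ιN w) ≡ true
  path-inPiece i here su fu = su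
  path-inPiece i (step {u} {w} e path) su fu =
    let (_ , fw , uw , f , cf) = linked-elim u w e in
    path-inPiece i path (SumFacts.nonadjacent-samePiece sum i (ιN u) (ιN w) (ιN f) su fu fw cf uw) fw

  bigClass-φ : ∀ ℓ a b → InClass ℓ a ≡ true → InClass ℓ b ≡ true → ¬ a ≡ b →
    Σ (Fin (n 𝔥)) λ φ → fat 𝔥 φ ≡ true × (∀ w → InClass ℓ w ≡ true → adj 𝔥 (ιN w) φ ≡ true) ×
      (∀ w f → InClass ℓ w ≡ true → fat 𝔥 f ≡ true → adj 𝔥 (ιN w) f ≡ true → f ≡ φ)
  bigClass-φ ℓ a b ca cb a≢b =
    φ , fφ , (λ w cw → adjφ (ιN w) (inside w cw) (proj₁ (inClass-elim cw))) ,
    (λ w f cw ff wf → onlyφ f (fatNbrs i₀ (ιN w) f (inside w cw) (proj₁ (inClass-elim cw)) ff wf) ff)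
    where
    fa = proj₁ (inClass-elim ca)
    i₀ = pieceOf (ιN a) fa
    inside : ∀ w → InClass ℓ w ≡ true → S i₀ (ιN w) ≡ true
    inside w cw = path-inPiece i₀ (class-path ca cw) (pieceOf-mem (ιN a) fa) fa
    shape = samePiece-oneFat i₀ (ιN a) (ιN b) (inside a ca) (inside b cb) fa (proj₁ (inClass-elim cb))
              (λ e → a≢b (incl-inj 𝔥 C a b e))
    φ = proj₁ shape
    fφ = proj₁ (proj₂ shape)
    onlyφ = proj₁ (proj₂ (proj₂ shape))
    adjφ = proj₂ (proj₂ (proj₂ shape))

  h₁Class-iso : ∀ ℓ → IsH₁Class ℓ ≡ true → Iso h₁ (sub N (InPiece ℓ))
  h₁Class-iso ℓ h = h₁-iso G (pieceHoffman ℓ) (⟨ x ⟩ px) (⟨ f ⟩ pf)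
    (trans (cong (fat N) (back px)) (proj₁ (inClass-elim cx)))
    (trans (cong (fat N) (back pf)) (proj₁ (fatOf-elim ℓ f ff)))
    (let (_ , x′ , cx′ , x′f) = fatOf-elim ℓ f ff in
     trans (cong₂ (adj N) (back px) (back pf)) (subst (λ z → adj N z f ≡ true) (oneSlim x′ x cx′ cx) x′f))
    onlyTwo
    where
    G = sub N (InPiece ℓ)
    ⟨_⟩_ : ∀ v → InPiece ℓ v ≡ true → Fin (n G)
    ⟨ v ⟩ pv = pre N (InPiece ℓ) v pv
    back : ∀ {v} (pv : InPiece ℓ v ≡ true) → incl N (InPiece ℓ) (⟨ v ⟩ pv) ≡ v
    back {v} pv = incl-pre N (InPiece ℓ) v pv
    counts = ∧-true₂ {Used ℓ} h
    oneClass : count (InClass ℓ) ≡ 1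
    oneClass = ≡ᵇ⇒≡ _ 1 (Equivalence.from T-≡ (∧-true₁ counts))
    oneFatNbr : count (FatOf ℓ) ≡ 1
    oneFatNbr = ≡ᵇ⇒≡ _ 1 (Equivalence.from T-≡ (∧-true₂ {count (InClass ℓ) ≡ᵇ 1} counts))
    oneSlim = count≡1⇒atMost1 (InClass ℓ) oneClass
    x = proj₁ (count≡1⇒witness (InClass ℓ) oneClass)
    cx = proj₂ (count≡1⇒witness (InClass ℓ) oneClass)
    f = proj₁ (count≡1⇒witness (FatOf ℓ) oneFatNbr)
    ff = proj₂ (count≡1⇒witness (FatOf ℓ) oneFatNbr)
    px : InPiece ℓ x ≡ true
    px = ∨-intro₁ cx
    pf : InPiece ℓ f ≡ true
    pf = ∨-intro₂ {InClass ℓ f} ff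
    onlyTwo : ∀ v → v ≡ ⟨ x ⟩ px ⊎ v ≡ ⟨ f ⟩ pf
    onlyTwo v = byCases (fat N w) refl
      where
      w = incl N (InPiece ℓ) v
      pw = incl-mem N (InPiece ℓ) v
      byCases : ∀ b → fat N w ≡ b → v ≡ ⟨ x ⟩ px ⊎ v ≡ ⟨ f ⟩ pf
      byCases false e = inj₁ (pre-unique N (InPiece ℓ) v x px (oneSlim w x (inPiece-slim ℓ w pw e) cx))
      byCases true e = inj₂ (pre-unique N (InPiece ℓ) v f pf
                         (count≡1⇒atMost1 (FatOf ℓ) oneFatNbr w f (inPiece-fat ℓ w pw e) ff))

  -- A one-vertex class whose vertex x does not have exactly one fat neighbour is
  -- a copy of h₂: x lies in a piece of 𝔥 which is not of the one-fat kind (there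
  -- x would have just one fat neighbour), so that piece is h₂ and supplies both.
  singleClass-h₂ : ∀ ℓ → count (InClass ℓ) ≡ 1 → ¬ count (FatOf ℓ) ≡ 1 → Iso h₂ (sub N (InPiece ℓ))
  singleClass-h₂ ℓ oneClass notOneFat = byShape (pieceShape i₀)
    where
    G = sub N (InPiece ℓ)
    x₀ = proj₁ (count≡1⇒witness (InClass ℓ) oneClass)
    cx₀ = proj₂ (count≡1⇒witness (InClass ℓ) oneClass)
    fx₀ = proj₁ (inClass-elim cx₀)
    x = ιN x₀
    i₀ = pieceOf x fx₀
    sx = pieceOf-mem x fx₀
    oneSlim = count≡1⇒atMost1 (InClass ℓ) oneClass
    fatOf-x : ∀ w → FatOf ℓ w ≡ true → fat 𝔥 (ιN w) ≡ true × adj 𝔥 x (ιN w) ≡ true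
    fatOf-x w fw = let (fw′ , x′ , cx′ , x′w) = fatOf-elim ℓ w fw in
      fw′ , subst (λ z → adj 𝔥 (ιN z) (ιN w) ≡ true) (oneSlim x′ x₀ cx′ cx₀) x′w
    toClass : ∀ f → fat 𝔥 f ≡ true → adj 𝔥 x f ≡ true → Σ (Fin (n N)) λ f′ → ιN f′ ≡ f × FatOf ℓ f′ ≡ true
    toClass f ff xf = let (f′ , e) = fatNbrN x₀ fx₀ f ff xf in
      f′ , e , fatOf-intro ℓ x₀ f′ cx₀ (trans (cong (fat 𝔥) e) ff) (trans (cong (adj 𝔥 x) e) xf)
    ⟨_⟩_ : ∀ v → InPiece ℓ v ≡ true → Fin (n G)
    ⟨ v ⟩ pv = pre N (InPiece ℓ) v pv
    back : ∀ {v} (pv : InPiece ℓ v ≡ true) → incl N (InPiece ℓ) (⟨ v ⟩ pv) ≡ v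
    back {v} pv = incl-pre N (InPiece ℓ) v pv

    byShape : PieceShape i₀ → Iso h₂ G
    byShape (oneFat φ fφ onlyφ adjφ) = ⊥-elim (notOneFat (count≡1 (FatOf ℓ) φ′ inφ atMost1))
      where
      φ′ = proj₁ (toClass φ fφ (adjφ x sx fx₀))
      inφ = proj₂ (proj₂ (toClass φ fφ (adjφ x sx fx₀)))
      isφ : ∀ w → FatOf ℓ w ≡ true → ιN w ≡ φ
      isφ w fw = let (fw′ , xw) = fatOf-x w fw in onlyφ (ιN w) (fatNbrs i₀ x (ιN w) sx fx₀ fw′ xw) fw′
      atMost1 : AtMost1 (FatOf ℓ)
      atMost1 a b fa fb = incl-inj 𝔥 C a b (trans (isφ a fa) (sym (isφ b fb)))
    byShape (twoFat s f₁ f₂ fs ff₁ ff₂ f₁≢f₂ sf₁ sf₂ onlyThree) =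
      h₂-iso G (pieceHoffman ℓ) (⟨ x₀ ⟩ px) (⟨ F₁ ⟩ p₁) (⟨ F₂ ⟩ p₂)
        (trans (cong (fat N) (back px)) fx₀)
        (trans (cong (fat N) (back p₁)) (trans (cong (fat 𝔥) e₁) ff₁))
        (trans (cong (fat N) (back p₂)) (trans (cong (fat 𝔥) e₂) ff₂))
        (λ e → f₁≢f₂ (trans (sym e₁) (trans (cong ιN (trans (sym (back p₁)) (trans (cong (incl N (InPiece ℓ)) e) (back p₂)))) e₂)))
        (trans (cong₂ (adj N) (back px) (back p₁)) (trans (cong (adj 𝔥 x) e₁) xf₁))
        (trans (cong₂ (adj N) (back px) (back p₂)) (trans (cong (adj 𝔥 x) e₂) xf₂))
        onlyThree′
      where
      slimIsS : x ≡ s ⊎ x ≡ f₁ ⊎ x ≡ f₂ → x ≡ s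
      slimIsS (inj₁ e) = e
      slimIsS (inj₂ (inj₁ e)) = ⊥-elim (fat-slim (trans (cong (fat 𝔥) e) ff₁) fx₀)
      slimIsS (inj₂ (inj₂ e)) = ⊥-elim (fat-slim (trans (cong (fat 𝔥) e) ff₂) fx₀)
      x≡s : x ≡ s
      x≡s = slimIsS (onlyThree x sx)
      xf₁ : adj 𝔥 x f₁ ≡ true
      xf₁ = subst (λ z → adj 𝔥 z f₁ ≡ true) (sym x≡s) sf₁
      xf₂ : adj 𝔥 x f₂ ≡ true
      xf₂ = subst (λ z → adj 𝔥 z f₂ ≡ true) (sym x≡s) sf₂
      F₁ = proj₁ (toClass f₁ ff₁ xf₁)
      e₁ = proj₁ (proj₂ (toClass f₁ ff₁ xf₁))
      F₂ = proj₁ (toClass f₂ ff₂ xf₂)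
      e₂ = proj₁ (proj₂ (toClass f₂ ff₂ xf₂))
      px : InPiece ℓ x₀ ≡ true
      px = ∨-intro₁ cx₀
      p₁ : InPiece ℓ F₁ ≡ true
      p₁ = ∨-intro₂ {InClass ℓ F₁} (proj₂ (proj₂ (toClass f₁ ff₁ xf₁)))
      p₂ : InPiece ℓ F₂ ≡ true
      p₂ = ∨-intro₂ {InClass ℓ F₂} (proj₂ (proj₂ (toClass f₂ ff₂ xf₂)))
      onlyThree′ : ∀ v → v ≡ ⟨ x₀ ⟩ px ⊎ v ≡ ⟨ F₁ ⟩ p₁ ⊎ v ≡ ⟨ F₂ ⟩ p₂
      onlyThree′ v = byCases (fat N w) refl
        where
        w = incl N (InPiece ℓ) v
        pw = incl-mem N (InPiece ℓ) v
        byCases : ∀ b → fat N w ≡ b → v ≡ ⟨ x₀ ⟩ px ⊎ v ≡ ⟨ F₁ ⟩ p₁ ⊎ v ≡ ⟨ F₂ ⟩ p₂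
        byCases false e = inj₁ (pre-unique N (InPiece ℓ) v x₀ px (oneSlim w x₀ (inPiece-slim ℓ w pw e) cx₀))
        byCases true e = pick (onlyThree (ιN w) (fatNbrs i₀ x (ιN w) sx fx₀ fw xw))
          where
          fw = proj₁ (fatOf-x w (inPiece-fat ℓ w pw e))
          xw = proj₂ (fatOf-x w (inPiece-fat ℓ w pw e))
          pick : ιN w ≡ s ⊎ ιN w ≡ f₁ ⊎ ιN w ≡ f₂ → v ≡ ⟨ x₀ ⟩ px ⊎ v ≡ ⟨ F₁ ⟩ p₁ ⊎ v ≡ ⟨ F₂ ⟩ p₂
          pick (inj₁ w≡s) = ⊥-elim (fat-slim fw (trans (cong (fat 𝔥) w≡s) fs))
          pick (inj₂ (inj₁ w≡f₁)) = inj₂ (inj₁ (pre-unique N (InPiece ℓ) v F₁ p₁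
                                      (incl-inj 𝔥 C w F₁ (trans w≡f₁ (sym e₁)))))
          pick (inj₂ (inj₂ w≡f₂)) = inj₂ (inj₂ (pre-unique N (InPiece ℓ) v F₂ p₂
                                      (incl-inj 𝔥 C w F₂ (trans w≡f₂ (sym e₂)))))

  -- A class with two distinct vertices a, b gives an indecomposable fat graph with
  -- one fat vertex φ: a decomposition into two sums would separate two class
  -- vertices, but linked vertices always lie in the same part of a sum.
  module BigClass (ℓ a b : V) (ca : InClass ℓ a ≡ true) (cb : InClass ℓ b ≡ true) (a≢b : ¬ a ≡ b) where

    G : HG
    G = sub N (InPiece ℓ)

    ιG : Fin (n G) → V
    ιG = incl N (InPiece ℓ)

    ⟨_⟩_ : ∀ v → InPiece ℓ v ≡ true → Fin (n G)
    ⟨ v ⟩ pv = pre N (InPiece ℓ) v pv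

    back : ∀ {v} (pv : InPiece ℓ v ≡ true) → ιG (⟨ v ⟩ pv) ≡ v
    back {v} pv = incl-pre N (InPiece ℓ) v pv

    φ-facts = bigClass-φ ℓ a b ca cb a≢b
    φ = proj₁ φ-facts
    fφ = proj₁ (proj₂ φ-facts)
    adjφ = proj₁ (proj₂ (proj₂ φ-facts))
    onlyφ = proj₂ (proj₂ (proj₂ φ-facts))

    fa = proj₁ (inClass-elim ca)
    φN = proj₁ (fatNbrN a fa φ fφ (adjφ a ca))
    eφ = proj₂ (fatNbrN a fa φ fφ (adjφ a ca))
    fφN : fat N φN ≡ true
    fφN = trans (cong (fat 𝔥) eφ) fφ
    adjφN : ∀ w → InClass ℓ w ≡ true → adj N w φN ≡ true
    adjφN w cw = trans (cong (adj 𝔥 (ιN w)) eφ) (adjφ w cw)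
    pφ : InPiece ℓ φN ≡ true
    pφ = ∨-intro₂ {InClass ℓ φN} (fatOf-intro ℓ a φN ca fφN (adjφN a ca))
    φG = ⟨ φN ⟩ pφ

    slimG-class : ∀ u → fat G u ≡ false → InClass ℓ (ιG u) ≡ true
    slimG-class u fu = inPiece-slim ℓ (ιG u) (incl-mem N (InPiece ℓ) u) fu

    fatG : FatHG G
    fatG u fu = φG , trans (cong (fat N) (back pφ)) fφN , trans (cong (adj N (ιG u)) (back pφ)) (adjφN (ιG u) (slimG-class u fu))

    isφ : ∀ u → fat G u ≡ true → ιN (ιG u) ≡ φ
    isφ u fu = let (ff , x , cx , xf) = fatOf-elim ℓ (ιG u) (inPiece-fat ℓ (ιG u) (incl-mem N (InPiece ℓ) u) fu) in
      onlyφ x (ιN (ιG u)) cx ff xf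

    oneFatG : numFat G ≡ 1
    oneFatG = count≡1 (fat G) φG (trans (cong (fat N) (back pφ)) fφN)
      (λ u u′ fu fu′ → incl-inj N (InPiece ℓ) u u′ (incl-inj 𝔥 C (ιG u) (ιG u′) (trans (isφ u fu) (sym (isφ u′ fu′)))))

    twoSlimG : 2 ≤ numSlim G
    twoSlimG = count≥2 (λ v → not (fat G v)) (⟨ a ⟩ ∨-intro₁ ca) (⟨ b ⟩ ∨-intro₁ cb)
      (not-false (trans (cong (fat N) (back (∨-intro₁ ca))) fa))
      (not-false (trans (cong (fat N) (back (∨-intro₁ cb))) (proj₁ (inClass-elim cb))))
      (λ e → a≢b (trans (sym (back (∨-intro₁ ca))) (trans (cong ιG e) (back (∨-intro₁ cb)))))

    walk : ∀ {k} {side : Fin k → Fin (n G) → Bool} → IsSum G k side → ∀ i {w w′} → Path w w′ →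
      InClass ℓ w ≡ true → ∀ g → ιG g ≡ w → side i g ≡ true → ∀ g′ → ιG g′ ≡ w′ → side i g′ ≡ true
    walk {side = side} _ i here _ g eg sg g′ eg′ =
      subst (λ z → side i z ≡ true) (incl-inj N (InPiece ℓ) g g′ (trans eg (sym eg′))) sg
    walk {side = side} sumG i (step {w} {v} e path) cw g refl sg g′ eg′ =
      walk sumG i path cv gv (back pv) (SumFacts.nonadjacent-samePiece sumG i g gv gf sg fg fgv cfG
        (trans (cong (adj N (ιG g)) (back pv)) wv)) g′ eg′
      where
      linked = linked-elim w v e
      fw = proj₁ linked
      fv = proj₁ (proj₂ linked)
      wv = proj₁ (proj₂ (proj₂ linked))
      f = proj₁ (proj₂ (proj₂ (proj₂ linked)))
      cf = proj₂ (proj₂ (proj₂ (proj₂ linked)))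
      cv : InClass ℓ v ≡ true
      cv = ∧-intro (not-false fv) (eqF-complete (trans (sym (edge-component w v e)) (proj₂ (inClass-elim cw))))
      pv = ∨-intro₁ {InClass ℓ v} cv
      gv = ⟨ v ⟩ pv
      fg : fat G g ≡ false
      fg = fw
      fgv : fat G gv ≡ false
      fgv = trans (cong (fat N) (back pv)) fv
      pf : InPiece ℓ f ≡ true
      pf = let (ff , wf , _) = commonFat-elim N cf in ∨-intro₂ {InClass ℓ f} (fatOf-intro ℓ w f cw ff wf)
      gf = ⟨ f ⟩ pf
      cfG : CommonFat G g gv gf ≡ true
      cfG = let (ff , wf , vf) = commonFat-elim N cf in
        commonFat-intro G (trans (cong (fat N) (back pf)) ff) (trans (cong (adj N w) (back pf)) wf)
          (trans (cong₂ (adj N) (back pv) (back pf)) vf)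

    indecomposable : Indecomposable G
    indecomposable (side , sumG , nonEmpty) =
      let (g₀ , s₀ , f₀) = slimOn zero ; (g₁ , s₁ , f₁) = slimOn (suc zero)
          c₀ = slimG-class g₀ f₀ ; c₁ = slimG-class g₁ f₁ in
      0≢1 (IsSum.slimUniq sumG g₁ f₁ zero (suc zero) (walk sumG zero (class-path c₀ c₁) c₀ g₀ refl s₀ g₁ refl) s₁)
      where
      0≢1 : ¬ Fin.zero {1} ≡ suc zero
      0≢1 ()
      slimOn : ∀ i → ∃ λ v → side i v ≡ true × fat G v ≡ false
      slimOn i = let (v , sv) = nonEmpty i in byCases v sv (fat G v) refl
        where
        byCases : ∀ v → side i v ≡ true → ∀ b → fat G v ≡ b → ∃ λ v′ → side i v′ ≡ true × fat G v′ ≡ false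
        byCases v sv false fv = v , sv , fv
        byCases v sv true fv = let (x , sx , fx , _) = subSlimNbr G (side i) (IsSum.pieces sumG i) v sv fv in x , sx , fx

    is𝒪 : 𝒪 G
    is𝒪 = inj₂ (pieceHoffman ℓ , indecomposable , fatG , twoSlimG , oneFatG)

  𝒪Class : ∀ ℓ → Is𝒪Class ℓ ≡ true → 𝒪 (sub N (InPiece ℓ))
  𝒪Class ℓ o = bySize (count (InClass ℓ)) refl
    where
    used = ∧-true₁ o
    notH₁ : IsH₁Class ℓ ≡ false
    notH₁ = not-true (∧-true₂ {Used ℓ} o)
    member = any-allFin⁻ (InClass ℓ) used
    bySize : ∀ k → count (InClass ℓ) ≡ k → 𝒪 (sub N (InPiece ℓ))
    bySize zero e = ⊥-elim (count-nonzero (InClass ℓ) (proj₁ member) (proj₂ member) e)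
    bySize (suc zero) e = inj₁ (singleClass-h₂ ℓ e notOneFat)
      where
      ᵇ-true : ∀ {k} → k ≡ 1 → (k ≡ᵇ 1) ≡ true
      ᵇ-true {k} e = Equivalence.to T-≡ (≡⇒≡ᵇ k 1 e)
      notOneFat : ¬ count (FatOf ℓ) ≡ 1
      notOneFat e₂ = true≢false (trans (sym (∧-intro used (∧-intro (ᵇ-true e) (ᵇ-true e₂)))) notH₁)
    bySize (suc (suc k)) e =
      let (a , b , ca , cb , a≢b) = count≥2⇒two (InClass ℓ) (subst (2 ≤_) (sym e) (s≤s (s≤s z≤n))) in
      BigClass.is𝒪 ℓ a b ca cb a≢b

  tildeDecomp : TildeDecomp N p q part
  tildeDecomp = decomposition , (λ j → h₁Class-iso (label (j ↑ˡ q)) (label-A j)) ,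
    (λ j → sub N (part (p ↑ʳ j)) , 𝒪Class (label (p ↑ʳ j)) (label-B j) , isoRefl _)

closure-decomposition : ∀ 𝔥 m S → IsSum 𝔥 m S → (∀ i → sub 𝔥 (S i) ∈ᶠ 𝒪) →
  ∀ X → (∀ v → X v ≡ true → fat 𝔥 v ≡ false) →
  ∃ λ p → ∃ λ q → Σ (Fin (p + q) → Fin (n (⟪_⟫ {𝔥} X)) → Bool) λ T → TildeDecomp (⟪_⟫ {𝔥} X) p q T
closure-decomposition 𝔥 m S sum in𝒪 X Xslim = p , q , part , tildeDecomp
  where open Decomposition 𝔥 m S sum in𝒪 X Xslim

image : ∀ {g h} → Emb g h → Fin (n h) → Bool
image {g} e v = any (λ u → eqF (ι e u) v) (allFin (n g))

image-intro : ∀ {g h} (e : Emb g h) u → image e (ι e u) ≡ true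
image-intro e u = any-allFin⁺ (λ u′ → eqF (ι e u′) (ι e u)) u (eqF-refl (ι e u))

image-elim : ∀ {g h} (e : Emb g h) v → image e v ≡ true → ∃ λ u → ι e u ≡ v
image-elim e v im = let (u , eu) = any-allFin⁻ (λ u → eqF (ι e u) v) im in u , eqF-sound eu

strictCover-pullback : ∀ {F g h c} (e : Emb g h) → StrictCover F (sub h (image e)) c → StrictCover F g c
strictCover-pullback {h = h} e (sumC , e′ , onto) = sumC , e′ ∘E e″ , λ y fy →
  let (x , ex) = onto y fy
      (u , eu) = image-elim e (incl h (image e) x) (incl-mem h (image e) x) in
  u , trans (cong (ι e′) (incl-inj h (image e) _ x (trans (incl-corestrict h (image e) e (image-intro e) u) eu))) ex
  where
  e″ = corestrict h (image e) e (image-intro e)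

slimLine-cover : ∀ ℋ → ℋ ⊆𝒪 → ∀ g → SlimLine ℋ g → ∃ λ c → StrictCover (bar ℋ) g c
slimLine-cover ℋ H𝒪 g (_ , allSlim , h , m , S , FS , e) =
  let (p , q , T , TD) = closure-decomposition h m S (proj₁ FS) (FSum-in𝒪 ℋ H𝒪 FS) (image e) imageSlim in
  _ , strictCover-pullback e (tilde-strictCover ℋ H𝒪 h m S FS (image e) imageSlim p q T TD)
  where
  imageSlim : ∀ v → image e v ≡ true → fat h v ≡ false
  imageSlim v im = let (u , eu) = image-elim e v im in trans (cong (fat h) (sym eu)) (trans (fatP e u) (allSlim u))

lemma3p6 : (ℋ : HG → Set) → ℋ ⊆𝒪 →
    ((𝔥 : HG) (k : ℕ) (S : Fin (suc k) → Fin (n 𝔥) → Bool) → IsFSum ℋ 𝔥 (suc k) S →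
      (X : Fin (n 𝔥) → Bool) → (∀ v → X v ≡ true → fat 𝔥 v ≡ false) →
      (∃ λ p → ∃ λ q → Σ (Fin (p + q) → Fin (n (⟪_⟫ {𝔥} X)) → Bool) λ T →
         TildeDecomp (⟪_⟫ {𝔥} X) p q T)
      × (∀ p q T → TildeDecomp (⟪_⟫ {𝔥} X) p q T →
           StrictCover (bar ℋ) (sub 𝔥 X) (tilde (⟪_⟫ {𝔥} X) p q T)))
    × (∀ g → SlimLine ℋ g → ∃ λ c → StrictCover (bar ℋ) g c)
lemma3p6 ℋ H𝒪 =
  (λ 𝔥 k S FS X Xslim →
     closure-decomposition 𝔥 (suc k) S (proj₁ FS) (FSum-in𝒪 ℋ H𝒪 FS) X Xslim ,
     tilde-strictCover ℋ H𝒪 𝔥 (suc k) S FS X Xslim) ,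
  slimLine-cover ℋ H𝒪
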